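{- The algorithm \texttt{EHEM} decides in time $\mathcal O(d!\cdot d^3)$ whether two nonsingular matrices $A,B\in\mathbb Z^{d\times d}$ with $|\det A|=|\det B|$ are UP-equivalent.
   Context: $\mathrm H(M)$ is the Hermite normal form of nonsingular $M\in\mathbb Z^{d\times d}$ (unique $UM$, $U\in\mathrm{GL}_d(\mathbb Z)$, upper triangular, positive diagonal, off-diagonal entries nonnegative and less than the diagonal entry of their column). For $\sigma\in\mathfrak S_d$, $M\cdot\sigma=M(\mathbf e_{\sigma(1)}|\cdots|\mathbf e_{\sigma(d)})$. $A,B$ are UP-equivalent if $UA=B\cdot\sigma$ for some $U\in\mathrm{GL}_d(\mathbb Z)$, $\sigma\in\mathfrak S_d$. \texttt{EHEM}$(A,B)$: fix an ordering $\mathrm{id}=\sigma_1,\dots,\sigma_{d!}$ of $\mathfrak S_d$ such that $\sigma_{i+1}=\sigma_i\tau_i$ with each $\tau_i$ an adjacent transposition $(j,j+1)$, and $\tau_0=\mathrm{id}$. Compute $F=\mathrm H(A)$, set $H_0=B$; for $i=0,\dots,d!-1$ compute $H_{i+1}=\mathrm H(H_i\cdot\tau_i)$ and return TRUE (with $\sigma_{i+1}$) if $H_{i+1}=F$; after the loop return FALSE. Time counts arithmetic operations (element multiplications), ignoring entry sizes. -}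

module Defs where

open import Data.Nat as ℕ using (ℕ; zero; suc)
open import Data.Integer as ℤ using (ℤ; +_; -[1+_]; _/ℕ_; ∣_∣)
open import Data.Fin as Fin using (Fin; toℕ; punchIn)
open import Data.Bool using (Bool; true; false; if_then_else_; _∧_)
open import Data.List as List using (List; []; _∷_; allFin; foldl; foldr; filterᵇ; length)
open import Data.List.Scans.Base using (scanl)
open import Data.List.Relation.Unary.Any using (Any)
open import Data.Maybe using (Maybe; just; nothing)
open import Data.Product using (Σ; _×_; _,_; proj₁; proj₂)
open import Data.Nat.GCD using (module Bézout)
open import Data.Fin.Permutation using (Permutation′; _⟨$⟩ʳ_)
open import Relation.Binary.PropositionalEquality using (_≡_)
open import Relation.Nullary.Decidable using (⌊_⌋)
open import Relation.Nullary.Negation using (¬_)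
open import Function using (id; _∘_)

-- Square integer matrices, d × d, as functions (row index, column index)

Matrix : ℕ → Set
Matrix d = Fin d → Fin d → ℤ

_≈M_ : ∀ {d} → Matrix d → Matrix d → Set
M ≈M N = ∀ r c → M r c ≡ N r c

∑ : ∀ d → (Fin d → ℤ) → ℤ
∑ zero    f = ℤ.0ℤ
∑ (suc d) f = f Fin.zero ℤ.+ ∑ d (f ∘ Fin.suc)

_*M_ : ∀ {d} → Matrix d → Matrix d → Matrix d
_*M_ {d} M N r c = ∑ d (λ k → M r k ℤ.* N k c)

I : ∀ {d} → Matrix d
I r c = if ⌊ r Fin.≟ c ⌋ then ℤ.1ℤ else ℤ.0ℤ

det : ∀ {d} → Matrix d → ℤ
det {zero}  M = ℤ.1ℤ
det {suc d} M =
  ∑ (suc d) (λ j → ((ℤ.- ℤ.1ℤ) ℤ.^ toℕ j) ℤ.* M Fin.zero j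
                    ℤ.* det {d} (λ r c → M (Fin.suc r) (punchIn j c)))

Nonsingular : ∀ {d} → Matrix d → Set
Nonsingular M = ¬ (det M ≡ ℤ.0ℤ)

Unimodular : ∀ {d} → Matrix d → Set
Unimodular {d} U = Σ (Matrix d) λ V → ((V *M U) ≈M I) × ((U *M V) ≈M I)

-- M · σ = M (e_σ(1) | ... | e_σ(d)) : column k of M·σ is column σ(k) of M
_·_ : ∀ {d} → Matrix d → (Fin d → Fin d) → Matrix d
(M · σ) r k = M r (σ k)

UPEquivalent : ∀ {d} → Matrix d → Matrix d → Set
UPEquivalent {d} A B =
  Σ (Matrix d) λ U → Σ (Permutation′ d) λ σ →
    Unimodular U × ((U *M A) ≈M (B · (σ ⟨$⟩ʳ_)))

record Adj (d : ℕ) : Set where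
  field
    i j : Fin d
    adjacent : toℕ j ≡ suc (toℕ i)

swapFin : ∀ {d} → Fin d → Fin d → Fin d → Fin d
swapFin i j k = if ⌊ k Fin.≟ i ⌋ then j else (if ⌊ k Fin.≟ j ⌋ then i else k)

adj⇒fun : ∀ {d} → Adj d → Fin d → Fin d
adj⇒fun τ = swapFin (Adj.i τ) (Adj.j τ)

-- σ_1 = id, σ_{i+1} = σ_i τ_i  (composition: apply τ_i first)
sigmas : ∀ {d} → List (Adj d) → List (Fin d → Fin d)
sigmas τs = scanl (λ σ τ → σ ∘ adj⇒fun τ) id τs

-- τ_1, …, τ_{d!-1} give an ordering σ_1, …, σ_{d!} of 𝔖_d:
-- exactly d! entries, and every permutation occurs among them
ValidOrdering : ∀ d → List (Adj d) → Set
ValidOrdering d τs =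
  (length τs ≡ d ℕ.! ℕ.∸ 1) ×
  (∀ (π : Permutation′ d) → Any (λ σ → ∀ k → σ k ≡ π ⟨$⟩ʳ k) (sigmas τs))

-- Every arithmetic operation on entries (addition, multiplication,
-- negation, comparison, division, one extended-gcd call) costs 1;
-- entry sizes are ignored.

Costed : Set → Set
Costed A = A × ℕ

-- extended gcd: egcd a b = (g , x , y) with g = gcd(a,b) ≥ 0 and x a + y b = g
sgn* : ℤ → ℕ → ℤ
sgn* (+ _)    x = + x
sgn* -[1+ _ ] x = ℤ.- (+ x)

egcd : ℤ → ℤ → ℕ × ℤ × ℤ
egcd a b with Bézout.lemma ∣ a ∣ ∣ b ∣
... | Bézout.result g _ (Bézout.+- x y _) = g , sgn* a x , ℤ.- sgn* b y
... | Bézout.result g _ (Bézout.-+ x y _) = g , ℤ.- sgn* a x , sgn* b y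

divN : ℤ → ℕ → ℤ
divN a zero    = ℤ.0ℤ
divN a (suc g) = a /ℕ suc g

combine : ∀ {d} → Fin d → Fin d → ℤ → ℤ → ℤ → ℤ → Matrix d → Costed (Matrix d)
combine {d} k i x y u v M =
  (λ r c → if ⌊ r Fin.≟ k ⌋ then x ℤ.* M k c ℤ.+ y ℤ.* M i c
           else if ⌊ r Fin.≟ i ⌋ then u ℤ.* M k c ℤ.+ v ℤ.* M i c
           else M r c) , 6 ℕ.* d

isZero : ℤ → Bool
isZero x = ⌊ x ℤ.≟ ℤ.0ℤ ⌋

isNeg : ℤ → Bool
isNeg (+ _)    = false
isNeg -[1+ _ ] = true

eliminate : ∀ {d} → Fin d → Costed (Matrix d) → Fin d → Costed (Matrix d)
eliminate {d} k (M , c) i =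
  if isZero (M i k) then (M , c ℕ.+ 1) else
  (let a = M k k ; b = M i k
       (g , x , y) = egcd a b
       (M′ , c′) = combine k i x y (ℤ.- divN b g) (divN a g) M
   in M′ , c ℕ.+ 4 ℕ.+ c′)

fixSign : ∀ {d} → Fin d → Costed (Matrix d) → Costed (Matrix d)
fixSign {d} k (M , c) =
  if isNeg (M k k)
  then ((λ r col → if ⌊ r Fin.≟ k ⌋ then ℤ.- M r col else M r col) , c ℕ.+ 1 ℕ.+ d)
  else (M , c ℕ.+ 1)

reduce : ∀ {d} → Fin d → Costed (Matrix d) → Fin d → Costed (Matrix d)
reduce {d} k (M , c) i with M k k
... | + (suc p) =
  let q = M i k /ℕ suc p
  in (λ r col → if ⌊ r Fin.≟ i ⌋ then M i col ℤ.- q ℤ.* M k col else M r col)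
     , c ℕ.+ 2 ℕ.+ 2 ℕ.* d
... | _ = M , c ℕ.+ 1

below above : ∀ {d} → Fin d → List (Fin d)
below {d} k = filterᵇ (λ i → toℕ k ℕ.<ᵇ toℕ i) (allFin d)
above {d} k = filterᵇ (λ i → toℕ i ℕ.<ᵇ toℕ k) (allFin d)

processColumn : ∀ {d} → Costed (Matrix d) → Fin d → Costed (Matrix d)
processColumn st k =
  foldl (reduce k) (fixSign k (foldl (eliminate k) st (below k))) (above k)

hnf : ∀ {d} → Matrix d → Costed (Matrix d)
hnf {d} M = foldl processColumn (M , 0) (allFin d)

H : ∀ {d} → Matrix d → Matrix d
H M = proj₁ (hnf M)

allᵇ : ∀ {A : Set} → (A → Bool) → List A → Bool
allᵇ p = foldr (λ x b → p x ∧ b) true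

eqM : ∀ {d} → Matrix d → Matrix d → Costed Bool
eqM {d} M N =
  allᵇ (λ r → allᵇ (λ c → ⌊ M r c ℤ.≟ N r c ⌋) (allFin d)) (allFin d) , d ℕ.* d

ehemLoop : ∀ {d} → Matrix d → Matrix d → (Fin d → Fin d) → ℕ →
           List (Fin d → Fin d) → Costed (Maybe (Fin d → Fin d))
ehemLoop F Hi σ c []       = nothing , c
ehemLoop F Hi σ c (τ ∷ τs) =
  let (Hn , c₁) = hnf (Hi · τ)
      (b , c₂)  = eqM Hn F
      σn        = σ ∘ τ
      c′        = c ℕ.+ c₁ ℕ.+ c₂
  in if b then (just σn , c′) else ehemLoop F Hn σn c′ τs

-- τ_0 = id followed by τ_1, …, τ_{d!-1}
EHEM : ∀ {d} → Matrix d → Matrix d → List (Adj d) → Costed (Maybe (Fin d → Fin d))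
EHEM A B τs =
  let (F , c₀) = hnf A
  in ehemLoop F B id c₀ (id ∷ List.map adj⇒fun τs)

-- The Hermite normal form is a complete invariant of row equivalence, so A and B·σ
-- are UP-equivalent through σ exactly when H(A) = H(B·σ); the loop computes, for σ running through
-- all of 𝔖_d, the normal form of a matrix row equivalent to B·σ.  Every step of the Hermite
-- algorithm is a unimodular row operation (a 2×2 block with determinant 1 on two rows, or the
-- negation of a row), which gives soundness.  Completeness rests on uniqueness: if U H₁ = H₂ with
-- both in Hermite form, then U is the identity, column by column, because the pivots force U c c = 1
-- and the off-diagonal entries of both matrices are least residues modulo the same pivot.  The
-- pivots of H(A) are positive because row operations preserve |det A| ≠ 0.  For the running time,
-- each of the d! iterations computes one normal form with O(d³) operations.

module Submission where

open import Defs
open import Data.Bool using (Bool; true; false; if_then_else_)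
open import Data.Empty using (⊥; ⊥-elim)
open import Data.Fin as Fin using (Fin; zero; suc; toℕ; punchIn; punchOut)
import Data.Fin.Properties as Finₚ
open import Data.Integer as ℤ using (ℤ; +_; -[1+_]; 0ℤ; 1ℤ; ∣_∣)
open import Data.Nat as ℕ using (ℕ; zero; suc)
import Data.Nat.Properties as ℕₚ
open import Data.Product using (Σ; ∃; _×_; _,_; proj₁; proj₂)
open import Data.Sum using (_⊎_; inj₁; inj₂)
open import Function using (id; _∘_)
open import Relation.Binary.PropositionalEquality
open import Relation.Nullary using (yes; no)
open import Relation.Nullary.Decidable using (⌊_⌋; toSum)

module Sums where

  open import Data.Integer using (_+_; _*_; -_)
  open import Data.Integer.Properties
  import Algebra.Properties.Semiring.Sum +-*-semiring as Sum

  ∑≡sum : ∀ d (f : Fin d → ℤ) → ∑ d f ≡ Sum.sum f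
  ∑≡sum zero    f = refl
  ∑≡sum (suc d) f = cong (_+_ (f zero)) (∑≡sum d (f ∘ suc))

  ∑-cong : ∀ d {f g : Fin d → ℤ} → (∀ i → f i ≡ g i) → ∑ d f ≡ ∑ d g
  ∑-cong zero    f≗g = refl
  ∑-cong (suc d) f≗g = cong₂ _+_ (f≗g zero) (∑-cong d (f≗g ∘ suc))

  ∑-zero : ∀ d (f : Fin d → ℤ) → (∀ i → f i ≡ 0ℤ) → ∑ d f ≡ 0ℤ
  ∑-zero zero    f f≗0 = refl
  ∑-zero (suc d) f f≗0 = cong₂ _+_ (f≗0 zero) (∑-zero d (f ∘ suc) (f≗0 ∘ suc))

  ∑-neg : ∀ d (f : Fin d → ℤ) → - ∑ d f ≡ ∑ d (λ i → - f i)
  ∑-neg zero    f = refl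
  ∑-neg (suc d) f = trans (neg-distrib-+ (f zero) _) (cong (_+_ (- f zero)) (∑-neg d (f ∘ suc)))

  ∑-distrib-+ : ∀ d (f g : Fin d → ℤ) → ∑ d (λ i → f i + g i) ≡ ∑ d f + ∑ d g
  ∑-distrib-+ d f g = begin
    ∑ d (λ i → f i + g i)     ≡⟨ ∑≡sum d _ ⟩
    Sum.sum (λ i → f i + g i) ≡⟨ Sum.∑-distrib-+ f g ⟩
    Sum.sum f + Sum.sum g     ≡⟨ sym (cong₂ _+_ (∑≡sum d f) (∑≡sum d g)) ⟩
    ∑ d f + ∑ d g             ∎
    where open ≡-Reasoning

  *-distribˡ-∑ : ∀ d (c : ℤ) (f : Fin d → ℤ) → c * ∑ d f ≡ ∑ d (λ i → c * f i)
  *-distribˡ-∑ d c f = begin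
    c * ∑ d f                ≡⟨ cong (c *_) (∑≡sum d f) ⟩
    c * Sum.sum f            ≡⟨ Sum.*-distribˡ-sum c f ⟩
    Sum.sum (λ i → c * f i)  ≡⟨ sym (∑≡sum d _) ⟩
    ∑ d (λ i → c * f i)      ∎
    where open ≡-Reasoning

  *-distribʳ-∑ : ∀ d (c : ℤ) (f : Fin d → ℤ) → ∑ d f * c ≡ ∑ d (λ i → f i * c)
  *-distribʳ-∑ d c f = begin
    ∑ d f * c                ≡⟨ cong (_* c) (∑≡sum d f) ⟩
    Sum.sum f * c            ≡⟨ Sum.*-distribʳ-sum c f ⟩
    Sum.sum (λ i → f i * c)  ≡⟨ sym (∑≡sum d _) ⟩
    ∑ d (λ i → f i * c)      ∎
    where open ≡-Reasoning

  ∑-linear : ∀ d (a b : ℤ) (f g : Fin d → ℤ) → ∑ d (λ j → a * f j + b * g j) ≡ a * ∑ d f + b * ∑ d g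
  ∑-linear d a b f g =
    trans (∑-distrib-+ d _ _) (sym (cong₂ _+_ (*-distribˡ-∑ d a f) (*-distribˡ-∑ d b g)))

  ∑-comm : ∀ d e (f : Fin d → Fin e → ℤ) → ∑ d (λ i → ∑ e (f i)) ≡ ∑ e (λ j → ∑ d (λ i → f i j))
  ∑-comm d e f = begin
    ∑ d (λ i → ∑ e (f i))                     ≡⟨ ∑-cong d (λ i → ∑≡sum e (f i)) ⟩
    ∑ d (λ i → Sum.sum (f i))                 ≡⟨ ∑≡sum d _ ⟩
    Sum.sum (λ i → Sum.sum (f i))             ≡⟨ Sum.∑-comm f ⟩
    Sum.sum (λ j → Sum.sum (λ i → f i j))     ≡⟨ sym (∑≡sum e _) ⟩
    ∑ e (λ j → Sum.sum (λ i → f i j))         ≡⟨ sym (∑-cong e (λ j → ∑≡sum d (λ i → f i j))) ⟩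
    ∑ e (λ j → ∑ d (λ i → f i j))             ∎
    where open ≡-Reasoning

  ∑-punchIn : ∀ d (f : Fin (suc d) → ℤ) (j : Fin (suc d)) → ∑ (suc d) f ≡ f j + ∑ d (f ∘ punchIn j)
  ∑-punchIn d f j = begin
    ∑ (suc d) f                       ≡⟨ ∑≡sum (suc d) f ⟩
    Sum.sum f                         ≡⟨ Sum.sum-remove f ⟩
    f j + Sum.sum (f ∘ punchIn j)     ≡⟨ sym (cong (_+_ (f j)) (∑≡sum d _)) ⟩
    f j + ∑ d (f ∘ punchIn j)         ∎
    where open ≡-Reasoning

  ∑-single : ∀ d (f : Fin d → ℤ) (k : Fin d) → (∀ i → i ≢ k → f i ≡ 0ℤ) → ∑ d f ≡ f k
  ∑-single (suc d) f k vanishes = begin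
    ∑ (suc d) f                 ≡⟨ ∑-punchIn d f k ⟩
    f k + ∑ d (f ∘ punchIn k)   ≡⟨ cong (_+_ (f k)) (∑-zero d _ (λ i → vanishes _ (Finₚ.punchInᵢ≢i k i))) ⟩
    f k + 0ℤ                    ≡⟨ +-identityʳ (f k) ⟩
    f k                         ∎
    where open ≡-Reasoning

module Folds where

  open import Data.List using ([]; _∷_; foldl)
  open import Data.List.Membership.Propositional using (_∈_)
  open import Data.List.Relation.Unary.Any using (here; there)

  module _ {S X : Set} (f : S → X → S) (Good : X → Set) (Valid : S → Set) (R : S → S → Set) (Done : X → S → Set)
           (R-refl : ∀ {s} → R s s) (R-trans : ∀ {s t u} → R s t → R t u → R s u)
           (R-valid : ∀ {s t} → R s t → Valid s → Valid t)
           (step : ∀ {s x} → Good x → Valid s → R s (f s x) × Done x (f s x))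
           (R-done : ∀ {s t x} → Good x → R s t → Done x s → Done x t) where

    foldl-sweep : ∀ xs s → (∀ {x} → x ∈ xs → Good x) → Valid s →
                  R s (foldl f s xs) × (∀ {x} → x ∈ xs → Done x (foldl f s xs))
    foldl-sweep []       s good valid = R-refl , λ ()
    foldl-sweep (x ∷ xs) s good valid with step (good (here refl)) valid
    ... | s↝fsx , done-x with foldl-sweep xs (f s x) (good ∘ there) (R-valid s↝fsx valid)
    ...   | fsx↝end , done-xs = R-trans s↝fsx fsx↝end , done
      where
      done : ∀ {y} → y ∈ x ∷ xs → Done y (foldl f (f s x) xs)
      done (here refl)  = R-done (good (here refl)) fsx↝end done-x
      done (there y∈xs) = done-xs y∈xs

module Matrices where

  open Sums
  open import Data.Integer using (_*_)
  open import Data.Integer.Properties using (*-assoc; *-zeroˡ; *-identityˡ)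

  ≈M-refl : ∀ {d} {M : Matrix d} → M ≈M M
  ≈M-refl r c = refl

  ≈M-sym : ∀ {d} {M N : Matrix d} → M ≈M N → N ≈M M
  ≈M-sym M≈N r c = sym (M≈N r c)

  ≈M-trans : ∀ {d} {M N P : Matrix d} → M ≈M N → N ≈M P → M ≈M P
  ≈M-trans M≈N N≈P r c = trans (M≈N r c) (N≈P r c)

  *M-cong : ∀ {d} {A A′ B B′ : Matrix d} → A ≈M A′ → B ≈M B′ → (A *M B) ≈M (A′ *M B′)
  *M-cong {d} A≈A′ B≈B′ r c = ∑-cong d (λ k → cong₂ _*_ (A≈A′ r k) (B≈B′ k c))

  *M-congˡ : ∀ {d} (A : Matrix d) {B B′ : Matrix d} → B ≈M B′ → (A *M B) ≈M (A *M B′)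
  *M-congˡ A = *M-cong (≈M-refl {M = A})

  *M-assoc : ∀ {d} (A B C : Matrix d) → ((A *M B) *M C) ≈M (A *M (B *M C))
  *M-assoc {d} A B C r c = begin
    ∑ d (λ k → ∑ d (λ j → A r j * B j k) * C k c)    ≡⟨ ∑-cong d (λ k → *-distribʳ-∑ d (C k c) _) ⟩
    ∑ d (λ k → ∑ d (λ j → A r j * B j k * C k c))    ≡⟨ ∑-comm d d _ ⟩
    ∑ d (λ j → ∑ d (λ k → A r j * B j k * C k c))    ≡⟨ ∑-cong d (λ j → ∑-cong d (λ k → *-assoc (A r j) (B j k) (C k c))) ⟩
    ∑ d (λ j → ∑ d (λ k → A r j * (B j k * C k c)))  ≡⟨ ∑-cong d (λ j → sym (*-distribˡ-∑ d (A r j) _)) ⟩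
    ∑ d (λ j → A r j * ∑ d (λ k → B j k * C k c))    ∎
    where open ≡-Reasoning

  I-diagonal : ∀ {d} (r : Fin d) → I r r ≡ 1ℤ
  I-diagonal r with r Fin.≟ r
  ... | yes _  = refl
  ... | no r≢r = ⊥-elim (r≢r refl)

  I-offDiagonal : ∀ {d} {r c : Fin d} → r ≢ c → I r c ≡ 0ℤ
  I-offDiagonal {r = r} {c} r≢c with r Fin.≟ c
  ... | yes r≡c = ⊥-elim (r≢c r≡c)
  ... | no _    = refl

  *M-identityˡ : ∀ {d} (M : Matrix d) → (I *M M) ≈M M
  *M-identityˡ {d} M r c = begin
    ∑ d (λ j → I r j * M j c) ≡⟨ ∑-single d _ r (λ j j≢r → trans (cong (_* M j c) (I-offDiagonal (j≢r ∘ sym))) (*-zeroˡ (M j c))) ⟩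
    I r r * M r c             ≡⟨ cong (_* M r c) (I-diagonal r) ⟩
    1ℤ * M r c                ≡⟨ *-identityˡ (M r c) ⟩
    M r c                     ∎
    where open ≡-Reasoning

  Unimodular-I : ∀ {d} → Unimodular {d} I
  Unimodular-I = I , *M-identityˡ I , *M-identityˡ I

  Unimodular-* : ∀ {d} {U U′ : Matrix d} → Unimodular U → Unimodular U′ → Unimodular (U′ *M U)
  Unimodular-* {d} {U} {U′} (V , VU≈I , UV≈I) (V′ , V′U′≈I , U′V′≈I) = V *M V′ , left , right
    where
    cancel : ∀ (A B C D : Matrix d) → (B *M C) ≈M I → ((A *M B) *M (C *M D)) ≈M (A *M D)
    cancel A B C D BC≈I = ≈M-trans (*M-assoc A B (C *M D))
      (*M-congˡ A (≈M-trans (≈M-sym (*M-assoc B C D)) (≈M-trans (*M-cong BC≈I (≈M-refl {M = D})) (*M-identityˡ D))))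
    left : ((V *M V′) *M (U′ *M U)) ≈M I
    left = ≈M-trans (cancel V V′ U′ U V′U′≈I) VU≈I
    right : ((U′ *M U) *M (V *M V′)) ≈M I
    right = ≈M-trans (cancel U′ U V V′ UV≈I) U′V′≈I

  RowEquivalent : ∀ {d} → Matrix d → Matrix d → Set
  RowEquivalent {d} M N = Σ (Matrix d) λ U → Unimodular U × ((U *M M) ≈M N)

  RowEquivalent-reflexive : ∀ {d} {M N : Matrix d} → M ≈M N → RowEquivalent M N
  RowEquivalent-reflexive {M = M} M≈N = I , Unimodular-I , ≈M-trans (*M-identityˡ M) M≈N

  RowEquivalent-trans : ∀ {d} {M N P : Matrix d} → RowEquivalent M N → RowEquivalent N P → RowEquivalent M P
  RowEquivalent-trans {M = M} (U , U-unimodular , UM≈N) (U′ , U′-unimodular , U′N≈P) =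
    U′ *M U , Unimodular-* U-unimodular U′-unimodular ,
    ≈M-trans (*M-assoc U′ U M) (≈M-trans (*M-congˡ U′ UM≈N) U′N≈P)

  RowEquivalent-sym : ∀ {d} {M N : Matrix d} → RowEquivalent M N → RowEquivalent N M
  RowEquivalent-sym {M = M} (U , (V , VU≈I , UV≈I) , UM≈N) = V , (U , UV≈I , VU≈I) ,
    ≈M-trans (*M-congˡ V (≈M-sym UM≈N))
      (≈M-trans (≈M-sym (*M-assoc V U M)) (≈M-trans (*M-cong VU≈I (≈M-refl {M = M})) (*M-identityˡ M)))

  RowEquivalent-respʳ : ∀ {d} {M N N′ : Matrix d} → RowEquivalent M N → N ≈M N′ → RowEquivalent M N′
  RowEquivalent-respʳ (U , U-unimodular , UM≈N) N≈N′ = U , U-unimodular , ≈M-trans UM≈N N≈N′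

  RowEquivalent-· : ∀ {d} {M N : Matrix d} (σ : Fin d → Fin d) → RowEquivalent M N → RowEquivalent (M · σ) (N · σ)
  RowEquivalent-· σ (U , U-unimodular , UM≈N) = U , U-unimodular , λ r k → UM≈N r (σ k)

  RowOperation : ∀ {d} → (Matrix d → Matrix d) → Set
  RowOperation f = ∀ M → f M ≈M (f I *M M)

  invertibleRowOperation-RowEquivalent : ∀ {d} {f g : Matrix d → Matrix d} → RowOperation f → RowOperation g →
    (∀ M → g (f M) ≈M M) → (∀ M → f (g M) ≈M M) → ∀ M → RowEquivalent M (f M)
  invertibleRowOperation-RowEquivalent {f = f} {g} f-row g-row gf≈id fg≈id M =
    f I , (g I , inverse g-row gf≈id , inverse f-row fg≈id) , ≈M-sym (f-row M)
    where
    inverse : ∀ {f g : Matrix _ → Matrix _} → RowOperation f → (∀ M → f (g M) ≈M M) → (f I *M g I) ≈M I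
    inverse f-row fg≈id = ≈M-trans (≈M-sym (f-row _)) (fg≈id I)

module RowOperations where

  open Sums
  open Matrices
  open import Data.Integer using (_+_; _*_; -_; _-_)
  open import Data.Integer.Properties using (*-assoc; *-distribʳ-+; -1*i≡-i; neg-involutive)
  open import Data.Integer.Solver using (module +-*-Solver)
  open +-*-Solver

  combineRows : ∀ {d} → Fin d → Fin d → ℤ → ℤ → ℤ → ℤ → Matrix d → Matrix d
  combineRows k i x y u v M = proj₁ (combine k i x y u v M)

  data RowCase {d} (k i : Fin d) : Fin d → Set where
    first  : RowCase k i k
    second : i ≢ k → RowCase k i i
    other  : ∀ {r} → r ≢ k → r ≢ i → RowCase k i r

  rowCase : ∀ {d} (k i r : Fin d) → RowCase k i r
  rowCase k i r with r Fin.≟ k | r Fin.≟ i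
  ... | yes refl | _        = first
  ... | no r≢k   | yes refl = second r≢k
  ... | no r≢k   | no r≢i   = other r≢k r≢i

  module _ {d} (k i : Fin d) (x y u v : ℤ) (M : Matrix d) where

    combineRows-first : ∀ c → combineRows k i x y u v M k c ≡ x * M k c + y * M i c
    combineRows-first c with k Fin.≟ k
    ... | yes _  = refl
    ... | no k≢k = ⊥-elim (k≢k refl)

    combineRows-second : i ≢ k → ∀ c → combineRows k i x y u v M i c ≡ u * M k c + v * M i c
    combineRows-second i≢k c with i Fin.≟ k | i Fin.≟ i
    ... | yes i≡k | _      = ⊥-elim (i≢k i≡k)
    ... | no _    | yes _  = refl
    ... | no _    | no i≢i = ⊥-elim (i≢i refl)

    combineRows-other : ∀ {r} → r ≢ k → r ≢ i → ∀ c → combineRows k i x y u v M r c ≡ M r c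
    combineRows-other {r} r≢k r≢i c with r Fin.≟ k | r Fin.≟ i
    ... | yes r≡k | _       = ⊥-elim (r≢k r≡k)
    ... | no _    | yes r≡i = ⊥-elim (r≢i r≡i)
    ... | no _    | no _    = refl

  ∑-I-row : ∀ {d} (p : Fin d) (a : ℤ) (M : Matrix d) c → ∑ d (λ j → (a * I p j) * M j c) ≡ a * M p c
  ∑-I-row {d} p a M c = begin
    ∑ d (λ j → (a * I p j) * M j c)  ≡⟨ ∑-cong d (λ j → *-assoc a (I p j) (M j c)) ⟩
    ∑ d (λ j → a * (I p j * M j c))  ≡⟨ sym (*-distribˡ-∑ d a _) ⟩
    a * (I *M M) p c                 ≡⟨ cong (a *_) (*M-identityˡ M p c) ⟩
    a * M p c                        ∎
    where open ≡-Reasoning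

  ∑-I-rows : ∀ {d} (p q : Fin d) (a b : ℤ) (M : Matrix d) c →
    ∑ d (λ j → (a * I p j + b * I q j) * M j c) ≡ a * M p c + b * M q c
  ∑-I-rows {d} p q a b M c =
    trans (∑-cong d (λ j → *-distribʳ-+ (M j c) (a * I p j) (b * I q j)))
          (trans (∑-distrib-+ d _ _) (cong₂ _+_ (∑-I-row p a M c) (∑-I-row q b M c)))

  combineRows-rowOperation : ∀ {d} (k i : Fin d) x y u v → i ≢ k → RowOperation (combineRows k i x y u v)
  combineRows-rowOperation {d} k i x y u v i≢k M r c with rowCase k i r
  ... | first = begin
    combineRows k i x y u v M k c                        ≡⟨ combineRows-first k i x y u v M c ⟩
    x * M k c + y * M i c                                ≡⟨ sym (∑-I-rows k i x y M c) ⟩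
    ∑ d (λ j → (x * I k j + y * I i j) * M j c)          ≡⟨ sym (∑-cong d (λ j → cong (_* M j c) (combineRows-first k i x y u v I j))) ⟩
    (combineRows k i x y u v I *M M) k c                 ∎
    where open ≡-Reasoning
  ... | second _ = begin
    combineRows k i x y u v M i c                        ≡⟨ combineRows-second k i x y u v M i≢k c ⟩
    u * M k c + v * M i c                                ≡⟨ sym (∑-I-rows k i u v M c) ⟩
    ∑ d (λ j → (u * I k j + v * I i j) * M j c)          ≡⟨ sym (∑-cong d (λ j → cong (_* M j c) (combineRows-second k i x y u v I i≢k j))) ⟩
    (combineRows k i x y u v I *M M) i c                 ∎
    where open ≡-Reasoning
  ... | other r≢k r≢i = begin
    combineRows k i x y u v M r c                        ≡⟨ combineRows-other k i x y u v M r≢k r≢i c ⟩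
    M r c                                                ≡⟨ sym (*M-identityˡ M r c) ⟩
    (I *M M) r c                                         ≡⟨ sym (∑-cong d (λ j → cong (_* M j c) (combineRows-other k i x y u v I r≢k r≢i j))) ⟩
    (combineRows k i x y u v I *M M) r c                 ∎
    where open ≡-Reasoning

  private
    compose : ∀ x y u v x′ y′ a b →
      x′ * (x * a + y * b) + y′ * (u * a + v * b) ≡ (x′ * x + y′ * u) * a + (x′ * y + y′ * v) * b
    compose = solve 8 (λ x y u v x′ y′ a b → x′ :* (x :* a :+ y :* b) :+ y′ :* (u :* a :+ v :* b)
                                          := (x′ :* x :+ y′ :* u) :* a :+ (x′ :* y :+ y′ :* v) :* b) refl

  module _ {d} (k i : Fin d) (i≢k : i ≢ k) (M : Matrix d) (x y u v x′ y′ u′ v′ : ℤ) where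

    private
      N  = combineRows k i x y u v M
      x″ = x′ * x + y′ * u
      y″ = x′ * y + y′ * v
      u″ = u′ * x + v′ * u
      v″ = u′ * y + v′ * v

    combineRows-∘ : combineRows k i x′ y′ u′ v′ N ≈M combineRows k i x″ y″ u″ v″ M
    combineRows-∘ r c with rowCase k i r
    ... | first = begin
      combineRows k i x′ y′ u′ v′ N k c                            ≡⟨ combineRows-first k i x′ y′ u′ v′ N c ⟩
      x′ * N k c + y′ * N i c
        ≡⟨ cong₂ (λ p q → x′ * p + y′ * q) (combineRows-first k i x y u v M c) (combineRows-second k i x y u v M i≢k c) ⟩
      x′ * (x * M k c + y * M i c) + y′ * (u * M k c + v * M i c)  ≡⟨ compose x y u v x′ y′ (M k c) (M i c) ⟩
      x″ * M k c + y″ * M i c                                      ≡⟨ sym (combineRows-first k i x″ y″ u″ v″ M c) ⟩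
      combineRows k i x″ y″ u″ v″ M k c                            ∎
      where open ≡-Reasoning
    ... | second _ = begin
      combineRows k i x′ y′ u′ v′ N i c                            ≡⟨ combineRows-second k i x′ y′ u′ v′ N i≢k c ⟩
      u′ * N k c + v′ * N i c
        ≡⟨ cong₂ (λ p q → u′ * p + v′ * q) (combineRows-first k i x y u v M c) (combineRows-second k i x y u v M i≢k c) ⟩
      u′ * (x * M k c + y * M i c) + v′ * (u * M k c + v * M i c)  ≡⟨ compose x y u v u′ v′ (M k c) (M i c) ⟩
      u″ * M k c + v″ * M i c                                      ≡⟨ sym (combineRows-second k i x″ y″ u″ v″ M i≢k c) ⟩
      combineRows k i x″ y″ u″ v″ M i c                            ∎
      where open ≡-Reasoning
    ... | other r≢k r≢i = begin
      combineRows k i x′ y′ u′ v′ N r c                            ≡⟨ combineRows-other k i x′ y′ u′ v′ N r≢k r≢i c ⟩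
      N r c                                                        ≡⟨ combineRows-other k i x y u v M r≢k r≢i c ⟩
      M r c                                                        ≡⟨ sym (combineRows-other k i x″ y″ u″ v″ M r≢k r≢i c) ⟩
      combineRows k i x″ y″ u″ v″ M r c                            ∎
      where open ≡-Reasoning

  combineRows-identity : ∀ {d} (k i : Fin d) → i ≢ k → (M : Matrix d) → combineRows k i 1ℤ 0ℤ 0ℤ 1ℤ M ≈M M
  combineRows-identity k i i≢k M r c with rowCase k i r
  ... | first          = trans (combineRows-first k i 1ℤ 0ℤ 0ℤ 1ℤ M c) (solve 2 (λ a b → con 1ℤ :* a :+ con 0ℤ :* b := a) refl (M k c) (M i c))
  ... | second _       = trans (combineRows-second k i 1ℤ 0ℤ 0ℤ 1ℤ M i≢k c) (solve 2 (λ a b → con 0ℤ :* a :+ con 1ℤ :* b := b) refl (M k c) (M i c))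
  ... | other r≢k r≢i  = combineRows-other k i 1ℤ 0ℤ 0ℤ 1ℤ M r≢k r≢i c

  combineRows-RowEquivalent : ∀ {d} (k i : Fin d) x y u v → i ≢ k → x * v - y * u ≡ 1ℤ →
    ∀ M → RowEquivalent M (combineRows k i x y u v M)
  combineRows-RowEquivalent k i x y u v i≢k xv-yu≡1 =
    invertibleRowOperation-RowEquivalent (combineRows-rowOperation k i x y u v i≢k)
      (combineRows-rowOperation k i v (- y) (- u) x i≢k) inverseˡ inverseʳ
    where
    identity-after : ∀ {x y u v} → x ≡ 1ℤ → y ≡ 0ℤ → u ≡ 0ℤ → v ≡ 1ℤ → ∀ M → combineRows k i x y u v M ≈M M
    identity-after refl refl refl refl = combineRows-identity k i i≢k
    det≡1 : ∀ {p} → p ≡ x * v - y * u → p ≡ 1ℤ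
    det≡1 p≡det = trans p≡det xv-yu≡1
    inverseˡ : ∀ M → combineRows k i v (- y) (- u) x (combineRows k i x y u v M) ≈M M
    inverseˡ M = ≈M-trans (combineRows-∘ k i i≢k M x y u v v (- y) (- u) x) (identity-after
      (det≡1 (solve 4 (λ x y u v → v :* x :+ (:- y) :* u := x :* v :- y :* u) refl x y u v))
      (solve 2 (λ y v → v :* y :+ (:- y) :* v := con 0ℤ) refl y v)
      (solve 2 (λ x u → (:- u) :* x :+ x :* u := con 0ℤ) refl x u)
      (det≡1 (solve 4 (λ x y u v → (:- u) :* y :+ x :* v := x :* v :- y :* u) refl x y u v)) M)
    inverseʳ : ∀ M → combineRows k i x y u v (combineRows k i v (- y) (- u) x M) ≈M M
    inverseʳ M = ≈M-trans (combineRows-∘ k i i≢k M v (- y) (- u) x x y u v) (identity-after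
      (det≡1 (solve 4 (λ x y u v → x :* v :+ y :* (:- u) := x :* v :- y :* u) refl x y u v))
      (solve 2 (λ x y → x :* (:- y) :+ y :* x := con 0ℤ) refl x y)
      (solve 2 (λ u v → u :* v :+ v :* (:- u) := con 0ℤ) refl u v)
      (det≡1 (solve 4 (λ x y u v → u :* (:- y) :+ v :* x := x :* v :- y :* u) refl x y u v)) M)

  negateRow : ∀ {d} → Fin d → Matrix d → Matrix d
  negateRow k M r c = if ⌊ r Fin.≟ k ⌋ then - M r c else M r c

  module _ {d} (k : Fin d) (M : Matrix d) where

    negateRow-row : ∀ c → negateRow k M k c ≡ - M k c
    negateRow-row c with k Fin.≟ k
    ... | yes _  = refl
    ... | no k≢k = ⊥-elim (k≢k refl)

    negateRow-other : ∀ {r} → r ≢ k → ∀ c → negateRow k M r c ≡ M r c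
    negateRow-other {r} r≢k c with r Fin.≟ k
    ... | yes r≡k = ⊥-elim (r≢k r≡k)
    ... | no _    = refl

  negateRow-rowOperation : ∀ {d} (k : Fin d) → RowOperation (negateRow k)
  negateRow-rowOperation {d} k M r c with toSum (r Fin.≟ k)
  ... | inj₁ refl = begin
    negateRow k M k c                   ≡⟨ negateRow-row k M c ⟩
    - M k c                             ≡⟨ sym (-1*i≡-i (M k c)) ⟩
    - 1ℤ * M k c                        ≡⟨ sym (∑-I-row k (- 1ℤ) M c) ⟩
    ∑ d (λ j → - 1ℤ * I k j * M j c)    ≡⟨ ∑-cong d (λ j → cong (_* M j c) (trans (-1*i≡-i (I k j)) (sym (negateRow-row k I j)))) ⟩
    (negateRow k I *M M) k c            ∎
    where open ≡-Reasoning
  ... | inj₂ r≢k = begin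
    negateRow k M r c                   ≡⟨ negateRow-other k M r≢k c ⟩
    M r c                               ≡⟨ sym (*M-identityˡ M r c) ⟩
    (I *M M) r c                        ≡⟨ sym (∑-cong d (λ j → cong (_* M j c) (negateRow-other k I r≢k j))) ⟩
    (negateRow k I *M M) r c            ∎
    where open ≡-Reasoning

  negateRow-involutive : ∀ {d} (k : Fin d) M → negateRow k (negateRow k M) ≈M M
  negateRow-involutive k M r c with toSum (r Fin.≟ k)
  ... | inj₁ refl = trans (negateRow-row k (negateRow k M) c) (trans (cong -_ (negateRow-row k M c)) (neg-involutive (M k c)))
  ... | inj₂ r≢k  = trans (negateRow-other k (negateRow k M) r≢k c) (negateRow-other k M r≢k c)

  negateRow-RowEquivalent : ∀ {d} (k : Fin d) M → RowEquivalent M (negateRow k M)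
  negateRow-RowEquivalent k = invertibleRowOperation-RowEquivalent
    (negateRow-rowOperation k) (negateRow-rowOperation k) (negateRow-involutive k) (negateRow-involutive k)

module Determinants where

  open Sums
  open Matrices
  open RowOperations
  open import Data.Integer using (_+_; _*_; -_; _-_; _^_)
  open import Data.Integer.Properties using (-1*i≡-i; neg-involutive; *-zeroˡ; *-zeroʳ; +-identityˡ)
  open import Data.Integer.Solver using (module +-*-Solver)
  open +-*-Solver

  sign : ℕ → ℤ
  sign n = (- 1ℤ) ^ n

  sign-suc : ∀ n → sign (suc n) ≡ - sign n
  sign-suc n = -1*i≡-i (sign n)

  minor : ∀ {d} → Matrix (suc d) → Fin (suc d) → Matrix d
  minor M j r c = M (suc r) (punchIn j c)

  term : ∀ {d} → Matrix (suc d) → Fin (suc d) → ℤ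
  term M j = sign (toℕ j) * M zero j * det (minor M j)

  det-cong : ∀ d {M N : Matrix d} → M ≈M N → det M ≡ det N
  det-cong zero    M≈N = refl
  det-cong (suc d) M≈N = ∑-cong (suc d) (λ j →
    cong₂ (λ a b → sign (toℕ j) * a * b) (M≈N zero j) (det-cong d (λ r c → M≈N (suc r) (punchIn j c))))

  private
    distribute : ∀ a b s n p x → s * (a * n + b * p) * x ≡ a * (s * n * x) + b * (s * p * x)
    distribute = solve 6 (λ a b s n p x → s :* (a :* n :+ b :* p) :* x
                                       := a :* (s :* n :* x) :+ b :* (s :* p :* x)) refl
    factor : ∀ a b s m x y → s * m * (a * x + b * y) ≡ a * (s * m * x) + b * (s * m * y)
    factor = solve 6 (λ a b s m x y → s :* m :* (a :* x :+ b :* y)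
                                   := a :* (s :* m :* x) :+ b :* (s :* m :* y)) refl

  det-linear : ∀ d (r : Fin d) (a b : ℤ) (M N P : Matrix d) →
    (∀ {t} → t ≢ r → ∀ c → M t c ≡ N t c) → (∀ {t} → t ≢ r → ∀ c → M t c ≡ P t c) →
    (∀ c → M r c ≡ a * N r c + b * P r c) → det M ≡ a * det N + b * det P
  det-linear (suc d) zero a b M N P M≡N M≡P row-r =
    trans (∑-cong (suc d) termwise) (∑-linear (suc d) a b (term N) (term P))
    where
    termwise : ∀ j → term M j ≡ a * term N j + b * term P j
    termwise j = begin
      sign (toℕ j) * M zero j * det (minor M j)
        ≡⟨ cong₂ (λ m x → sign (toℕ j) * m * x) (row-r j) (det-cong d (λ t c → M≡N (λ ()) (punchIn j c))) ⟩
      sign (toℕ j) * (a * N zero j + b * P zero j) * det (minor N j)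
        ≡⟨ distribute a b (sign (toℕ j)) (N zero j) (P zero j) (det (minor N j)) ⟩
      a * term N j + b * (sign (toℕ j) * P zero j * det (minor N j))
        ≡⟨ cong (λ x → a * term N j + b * (sign (toℕ j) * P zero j * x))
                (det-cong d (λ t c → trans (sym (M≡N (λ ()) (punchIn j c))) (M≡P (λ ()) (punchIn j c)))) ⟩
      a * term N j + b * term P j ∎
      where open ≡-Reasoning
  det-linear (suc d) (suc r) a b M N P M≡N M≡P row-r =
    trans (∑-cong (suc d) termwise) (∑-linear (suc d) a b (term N) (term P))
    where
    termwise : ∀ j → term M j ≡ a * term N j + b * term P j
    termwise j = begin
      sign (toℕ j) * M zero j * det (minor M j)
        ≡⟨ cong (sign (toℕ j) * M zero j *_) (det-linear d r a b (minor M j) (minor N j) (minor P j)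
             (λ t≢r c → M≡N (t≢r ∘ Finₚ.suc-injective) (punchIn j c))
             (λ t≢r c → M≡P (t≢r ∘ Finₚ.suc-injective) (punchIn j c))
             (λ c → row-r (punchIn j c))) ⟩
      sign (toℕ j) * M zero j * (a * det (minor N j) + b * det (minor P j))
        ≡⟨ factor a b (sign (toℕ j)) (M zero j) (det (minor N j)) (det (minor P j)) ⟩
      a * (sign (toℕ j) * M zero j * det (minor N j)) + b * (sign (toℕ j) * M zero j * det (minor P j))
        ≡⟨ cong₂ (λ n p → a * (sign (toℕ j) * n * det (minor N j)) + b * (sign (toℕ j) * p * det (minor P j)))
                 (M≡N (λ ()) j) (M≡P (λ ()) j) ⟩
      a * term N j + b * term P j ∎
      where open ≡-Reasoning

  record RowSwap {d} (r s : Fin d) (M M′ : Matrix d) : Set where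
    field
      at-r      : ∀ c → M′ r c ≡ M s c
      at-s      : ∀ c → M′ s c ≡ M r c
      elsewhere : ∀ {t} → t ≢ r → t ≢ s → ∀ c → M′ t c ≡ M t c

  RowSwap-sym : ∀ {d} {r s : Fin d} {M M′ : Matrix d} → RowSwap r s M M′ → RowSwap s r M M′
  RowSwap-sym sw = record { at-r = at-s ; at-s = at-r ; elsewhere = λ t≢s t≢r → elsewhere t≢r t≢s }
    where open RowSwap sw

  punchIn-punchIn : ∀ {n} (j : Fin (suc (suc n))) (l : Fin (suc n)) (c : Fin n) (jl≢j : punchIn j l ≢ j) →
    punchIn j (punchIn l c) ≡ punchIn (punchIn j l) (punchIn (punchOut jl≢j) c)
  punchIn-punchIn zero    l       c       jl≢j = refl
  punchIn-punchIn (suc j) zero    c       jl≢j = refl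
  punchIn-punchIn (suc j) (suc l) zero    jl≢j = refl
  punchIn-punchIn (suc j) (suc l) (suc c) jl≢j = cong suc (punchIn-punchIn j l c (jl≢j ∘ cong suc))

  sign-punchIn-punchOut : ∀ {n} (j : Fin (suc (suc n))) (l : Fin (suc n)) (jl≢j : punchIn j l ≢ j) →
    sign (toℕ (punchIn j l)) * sign (toℕ (punchOut jl≢j)) ≡ - (sign (toℕ j) * sign (toℕ l))
  sign-punchIn-punchOut zero l jl≢j =
    trans (cong (_* 1ℤ) (sign-suc (toℕ l))) (solve 1 (λ s → (:- s) :* con 1ℤ := :- (con 1ℤ :* s)) refl (sign (toℕ l)))
  sign-punchIn-punchOut (suc j) zero jl≢j =
    sym (trans (cong (λ s → - (s * 1ℤ)) (sign-suc (toℕ j))) (solve 1 (λ s → :- ((:- s) :* con 1ℤ) := con 1ℤ :* s) refl (sign (toℕ j))))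
  sign-punchIn-punchOut {suc n} (suc j) (suc l) jl≢j = begin
    sign (suc (toℕ (punchIn j l))) * sign (suc (toℕ (punchOut jl≢j′)))
      ≡⟨ cong₂ _*_ (sign-suc (toℕ (punchIn j l))) (sign-suc (toℕ (punchOut jl≢j′))) ⟩
    (- sign (toℕ (punchIn j l))) * (- sign (toℕ (punchOut jl≢j′)))
      ≡⟨ neg-*-neg (sign (toℕ (punchIn j l))) _ ⟩
    sign (toℕ (punchIn j l)) * sign (toℕ (punchOut jl≢j′))
      ≡⟨ sign-punchIn-punchOut j l jl≢j′ ⟩
    - (sign (toℕ j) * sign (toℕ l))
      ≡⟨ cong -_ (sym (neg-*-neg (sign (toℕ j)) (sign (toℕ l)))) ⟩
    - ((- sign (toℕ j)) * (- sign (toℕ l)))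
      ≡⟨ cong -_ (sym (cong₂ _*_ (sign-suc (toℕ j)) (sign-suc (toℕ l)))) ⟩
    - (sign (suc (toℕ j)) * sign (suc (toℕ l))) ∎
    where
    open ≡-Reasoning
    jl≢j′ = jl≢j ∘ cong suc
    neg-*-neg : ∀ a b → (- a) * (- b) ≡ a * b
    neg-*-neg = solve 2 (λ a b → (:- a) :* (:- b) := a :* b) refl

  -- Reindexes a family over pairs (j , l) as a family over pairs (j , punchIn j l) of distinct
  -- indices, extended by zero on the diagonal, so that the two summation orders can be exchanged.
  offDiagonal : ∀ {n} → (Fin (suc n) → Fin n → ℤ) → Fin (suc n) → Fin (suc n) → ℤ
  offDiagonal F j j′ with j Fin.≟ j′
  ... | yes _    = 0ℤ
  ... | no j≢j′  = F j (punchOut j≢j′)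

  offDiagonal-diagonal : ∀ {n} (F : Fin (suc n) → Fin n → ℤ) j → offDiagonal F j j ≡ 0ℤ
  offDiagonal-diagonal F j with j Fin.≟ j
  ... | yes _  = refl
  ... | no j≢j = ⊥-elim (j≢j refl)

  offDiagonal-punchIn : ∀ {n} (F : Fin (suc n) → Fin n → ℤ) j l → offDiagonal F j (punchIn j l) ≡ F j l
  offDiagonal-punchIn F j l with j Fin.≟ punchIn j l
  ... | yes j≡jl = ⊥-elim (Finₚ.punchInᵢ≢i j l (sym j≡jl))
  ... | no _     = cong (F j) (trans (Finₚ.punchOut-cong j refl) (Finₚ.punchOut-punchIn j))

  ∑-offDiagonal : ∀ n (F : Fin (suc n) → Fin n → ℤ) j → ∑ (suc n) (offDiagonal F j) ≡ ∑ n (F j)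
  ∑-offDiagonal n F j = begin
    ∑ (suc n) (offDiagonal F j)                             ≡⟨ ∑-punchIn n (offDiagonal F j) j ⟩
    offDiagonal F j j + ∑ n (offDiagonal F j ∘ punchIn j)   ≡⟨ cong₂ _+_ (offDiagonal-diagonal F j) (∑-cong n (offDiagonal-punchIn F j)) ⟩
    0ℤ + ∑ n (F j)                                          ≡⟨ +-identityˡ _ ⟩
    ∑ n (F j)                                               ∎
    where open ≡-Reasoning

  module _ {n} (F G : Fin (suc n) → Fin n → ℤ)
           (antisym : ∀ j l (jl≢j : punchIn j l ≢ j) → G (punchIn j l) (punchOut jl≢j) ≡ - F j l) where

    offDiagonal-antisym : ∀ j j′ → offDiagonal G j j′ ≡ - offDiagonal F j′ j
    offDiagonal-antisym j j′ with j′ Fin.≟ j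
    ... | yes refl  = offDiagonal-diagonal G j
    ... | no j′≢j   = at-punchIn j′ (punchOut j′≢j) j (Finₚ.punchIn-punchOut j′≢j)
      where
      at-punchIn : ∀ j′ l j → punchIn j′ l ≡ j → offDiagonal G j j′ ≡ - F j′ l
      at-punchIn j′ l .(punchIn j′ l) refl with punchIn j′ l Fin.≟ j′
      ... | yes jl≡j = ⊥-elim (Finₚ.punchInᵢ≢i j′ l jl≡j)
      ... | no jl≢j  = antisym j′ l jl≢j

    ∑∑-antisym : ∑ (suc n) (λ j → ∑ n (G j)) ≡ - ∑ (suc n) (λ j → ∑ n (F j))
    ∑∑-antisym = begin
      ∑ (suc n) (λ j → ∑ n (G j))                                   ≡⟨ ∑-cong (suc n) (λ j → sym (∑-offDiagonal n G j)) ⟩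
      ∑ (suc n) (λ j → ∑ (suc n) (offDiagonal G j))                 ≡⟨ ∑-comm (suc n) (suc n) (offDiagonal G) ⟩
      ∑ (suc n) (λ j′ → ∑ (suc n) (λ j → offDiagonal G j j′))       ≡⟨ ∑-cong (suc n) (λ j′ → ∑-cong (suc n) (λ j → offDiagonal-antisym j j′)) ⟩
      ∑ (suc n) (λ j′ → ∑ (suc n) (λ j → - offDiagonal F j′ j))     ≡⟨ sym (∑-cong (suc n) (λ j′ → ∑-neg (suc n) (offDiagonal F j′))) ⟩
      ∑ (suc n) (λ j′ → - ∑ (suc n) (offDiagonal F j′))             ≡⟨ sym (∑-neg (suc n) (λ j′ → ∑ (suc n) (offDiagonal F j′))) ⟩
      - ∑ (suc n) (λ j′ → ∑ (suc n) (offDiagonal F j′))             ≡⟨ cong -_ (∑-cong (suc n) (∑-offDiagonal n F)) ⟩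
      - ∑ (suc n) (λ j′ → ∑ n (F j′))                               ∎
      where open ≡-Reasoning

  pairTerm : ∀ {n} (a b : Fin (suc (suc n)) → ℤ) (R : Fin n → Fin (suc (suc n)) → ℤ) →
    Fin (suc (suc n)) → Fin (suc n) → ℤ
  pairTerm {n} a b R j l =
    sign (toℕ j) * sign (toℕ l) * a j * b (punchIn j l) * det {n} (λ r c → R r (punchIn j (punchIn l c)))

  det-expand-firstTwoRows : ∀ n (M : Matrix (suc (suc n))) →
    det M ≡ ∑ (suc (suc n)) (λ j → ∑ (suc n) (pairTerm (M zero) (M (suc zero)) ((λ r → M (suc (suc r)))) j))
  det-expand-firstTwoRows n M = ∑-cong (suc (suc n)) (λ j →
    trans (*-distribˡ-∑ (suc n) (sign (toℕ j) * M zero j) (term (minor M j)))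
          (∑-cong (suc n) (λ l → regroup (sign (toℕ j)) (M zero j) (sign (toℕ l)) (M (suc zero) (punchIn j l)) (det (minor (minor M j) l)))))
    where
    regroup : ∀ s a t b x → s * a * (t * b * x) ≡ s * t * a * b * x
    regroup = solve 5 (λ s a t b x → s :* a :* (t :* b :* x) := s :* t :* a :* b :* x) refl

  -- Swapping the first two rows pairs each term of the expansion with one of opposite sign.
  pairTerm-antisym : ∀ {n} (a b : Fin (suc (suc n)) → ℤ) (R : Fin n → Fin (suc (suc n)) → ℤ) →
    ∀ j l (jl≢j : punchIn j l ≢ j) → pairTerm b a R (punchIn j l) (punchOut jl≢j) ≡ - pairTerm a b R j l
  pairTerm-antisym {n} a b R j l jl≢j = begin
    sign (toℕ jl) * sign (toℕ l′) * b jl * a (punchIn jl l′) * det (λ r c → R r (punchIn jl (punchIn l′ c)))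
      ≡⟨ cong₂ (λ s x → s * b jl * a x * det (λ r c → R r (punchIn jl (punchIn l′ c))))
               (sign-punchIn-punchOut j l jl≢j) (Finₚ.punchIn-punchOut jl≢j) ⟩
    (- (sign (toℕ j) * sign (toℕ l))) * b jl * a j * det (λ r c → R r (punchIn jl (punchIn l′ c)))
      ≡⟨ cong (λ x → (- (sign (toℕ j) * sign (toℕ l))) * b jl * a j * x)
              (det-cong n (λ r c → cong (R r) (sym (punchIn-punchIn j l c jl≢j)))) ⟩
    (- (sign (toℕ j) * sign (toℕ l))) * b jl * a j * det (λ r c → R r (punchIn j (punchIn l c)))
      ≡⟨ reorder (sign (toℕ j)) (sign (toℕ l)) (a j) (b jl) _ ⟩
    - pairTerm a b R j l ∎
    where
    open ≡-Reasoning
    jl = punchIn j l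
    l′ = punchOut jl≢j
    reorder : ∀ s t x y z → (- (s * t)) * y * x * z ≡ - (s * t * x * y * z)
    reorder = solve 5 (λ s t x y z → (:- (s :* t)) :* y :* x :* z := :- (s :* t :* x :* y :* z)) refl

  det-swap-firstTwoRows : ∀ n {M M′ : Matrix (suc (suc n))} → RowSwap zero (suc zero) M M′ → det M′ ≡ - det M
  det-swap-firstTwoRows n {M} {M′} sw = begin
    det M′                                                  ≡⟨ det-expand-firstTwoRows n M′ ⟩
    ∑ (suc (suc n)) (λ j → ∑ (suc n) (pairTerm a′ b′ R′ j))  ≡⟨ ∑-cong (suc (suc n)) (λ j → ∑-cong (suc n) (swapped j)) ⟩
    ∑ (suc (suc n)) (λ j → ∑ (suc n) (pairTerm b a R j))    ≡⟨ ∑∑-antisym (pairTerm a b R) (pairTerm b a R) (pairTerm-antisym a b R) ⟩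
    - ∑ (suc (suc n)) (λ j → ∑ (suc n) (pairTerm a b R j))  ≡⟨ cong -_ (sym (det-expand-firstTwoRows n M)) ⟩
    - det M                                                 ∎
    where
    open ≡-Reasoning
    open RowSwap sw
    a = M zero
    b = M (suc zero)
    R = (λ r → M (suc (suc r)))
    a′ = M′ zero
    b′ = M′ (suc zero)
    R′ = (λ r → M′ (suc (suc r)))
    swapped : ∀ j l → pairTerm a′ b′ R′ j l ≡ pairTerm b a R j l
    swapped j l = cong₂ _*_
      (cong₂ (λ x y → sign (toℕ j) * sign (toℕ l) * x * y) (at-r j) (at-s (punchIn j l)))
      (det-cong n (λ r c → elsewhere (λ ()) (λ ()) (punchIn j (punchIn l c))))

  swapRows : ∀ {d} → Fin d → Fin d → Matrix d → Matrix d
  swapRows k i = combineRows k i 0ℤ 1ℤ 1ℤ 0ℤ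

  swapRows-RowSwap : ∀ {d} {k i : Fin d} → i ≢ k → (M : Matrix d) → RowSwap k i M (swapRows k i M)
  swapRows-RowSwap {k = k} {i} i≢k M = record
    { at-r      = λ c → trans (combineRows-first k i 0ℤ 1ℤ 1ℤ 0ℤ M c) (solve 2 (λ a b → con 0ℤ :* a :+ con 1ℤ :* b := b) refl (M k c) (M i c))
    ; at-s      = λ c → trans (combineRows-second k i 0ℤ 1ℤ 1ℤ 0ℤ M i≢k c) (solve 2 (λ a b → con 1ℤ :* a :+ con 0ℤ :* b := a) refl (M k c) (M i c))
    ; elsewhere = combineRows-other k i 0ℤ 1ℤ 1ℤ 0ℤ M
    }

  SwapNegatesDet : ℕ → Set
  SwapNegatesDet d = ∀ {r s : Fin d} {M M′ : Matrix d} → r ≢ s → RowSwap r s M M′ → det M′ ≡ - det M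

  det-swap-lowerRows : ∀ d → SwapNegatesDet d → ∀ {r s : Fin d} {M M′ : Matrix (suc d)} →
    r ≢ s → RowSwap (suc r) (suc s) M M′ → det M′ ≡ - det M
  det-swap-lowerRows d swap-minor {r} {s} {M} {M′} r≢s sw = begin
    ∑ (suc d) (term M′)                   ≡⟨ ∑-cong (suc d) termwise ⟩
    ∑ (suc d) (λ j → - term M j)          ≡⟨ sym (∑-neg (suc d) (term M)) ⟩
    - ∑ (suc d) (term M)                  ∎
    where
    open ≡-Reasoning
    open RowSwap sw
    minors-swap : ∀ j → RowSwap r s (minor M j) (minor M′ j)
    minors-swap j = record
      { at-r      = λ c → at-r (punchIn j c)
      ; at-s      = λ c → at-s (punchIn j c)
      ; elsewhere = λ t≢r t≢s c → elsewhere (t≢r ∘ Finₚ.suc-injective) (t≢s ∘ Finₚ.suc-injective) (punchIn j c)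
      }
    termwise : ∀ j → term M′ j ≡ - term M j
    termwise j = trans
      (cong₂ (λ m x → sign (toℕ j) * m * x) (elsewhere (λ ()) (λ ()) j) (swap-minor r≢s (minors-swap j)))
      (solve 3 (λ s m x → s :* m :* (:- x) := :- (s :* m :* x)) refl (sign (toℕ j)) (M zero j) (det (minor M j)))

  -- The transposition (0 s) is the conjugate (1 s) (0 1) (1 s).
  RowSwap-conjugate : ∀ {n} {s : Fin n} {M M′ M₁ M₂ M₃ : Matrix (suc (suc n))} →
    let one = suc zero ; ss = suc (suc s) in
    RowSwap zero ss M M′ → RowSwap one ss M M₁ → RowSwap zero one M₁ M₂ → RowSwap one ss M₂ M₃ → M′ ≈M M₃
  RowSwap-conjugate {s = s} {M} {M′} {M₁} {M₂} {M₃} sw sw₁ sw₂ sw₃ = M′≈M₃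
    where
    open ≡-Reasoning
    open RowSwap
    one = suc zero
    ss  = suc (suc s)
    M′≈M₃ : M′ ≈M M₃
    M′≈M₃ zero c = begin
      M′ zero c   ≡⟨ at-r sw c ⟩
      M ss c      ≡⟨ sym (at-r sw₁ c) ⟩
      M₁ one c    ≡⟨ sym (at-r sw₂ c) ⟩
      M₂ zero c   ≡⟨ sym (elsewhere sw₃ {zero} (λ ()) (λ ()) c) ⟩
      M₃ zero c   ∎
    M′≈M₃ (suc zero) c = begin
      M′ one c    ≡⟨ elsewhere sw {one} (λ ()) (λ ()) c ⟩
      M one c     ≡⟨ sym (at-s sw₁ c) ⟩
      M₁ ss c     ≡⟨ sym (elsewhere sw₂ {ss} (λ ()) (λ ()) c) ⟩
      M₂ ss c     ≡⟨ sym (at-r sw₃ c) ⟩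
      M₃ one c    ∎
    M′≈M₃ (suc (suc t)) c with toSum (t Fin.≟ s)
    ... | inj₁ refl = begin
      M′ ss c     ≡⟨ at-s sw c ⟩
      M zero c    ≡⟨ sym (elsewhere sw₁ {zero} (λ ()) (λ ()) c) ⟩
      M₁ zero c   ≡⟨ sym (at-s sw₂ c) ⟩
      M₂ one c    ≡⟨ sym (at-s sw₃ c) ⟩
      M₃ ss c     ∎
    ... | inj₂ t≢s = begin
      M′ tt c     ≡⟨ elsewhere sw {tt} (λ ()) tt≢ss c ⟩
      M tt c      ≡⟨ sym (elsewhere sw₁ {tt} (λ ()) tt≢ss c) ⟩
      M₁ tt c     ≡⟨ sym (elsewhere sw₂ {tt} (λ ()) (λ ()) c) ⟩
      M₂ tt c     ≡⟨ sym (elsewhere sw₃ {tt} (λ ()) tt≢ss c) ⟩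
      M₃ tt c     ∎
      where
      tt = suc (suc t)
      tt≢ss : tt ≢ ss
      tt≢ss = t≢s ∘ Finₚ.suc-injective ∘ Finₚ.suc-injective

  det-swap-topRow : ∀ d → SwapNegatesDet d → ∀ {s : Fin d} {M M′ : Matrix (suc d)} →
    RowSwap zero (suc s) M M′ → det M′ ≡ - det M
  det-swap-topRow (suc d) swap-minor {zero}  sw = det-swap-firstTwoRows d sw
  det-swap-topRow (suc d) swap-minor {suc s} {M} {M′} sw = begin
    det M′            ≡⟨ det-cong (suc (suc d)) (RowSwap-conjugate sw sw₁ sw₂ sw₃) ⟩
    det M₃            ≡⟨ det-swap-lowerRows (suc d) swap-minor 0≢s+1 sw₃ ⟩
    - det M₂          ≡⟨ cong -_ (det-swap-firstTwoRows d sw₂) ⟩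
    - - det M₁        ≡⟨ neg-involutive (det M₁) ⟩
    det M₁            ≡⟨ det-swap-lowerRows (suc d) swap-minor 0≢s+1 sw₁ ⟩
    - det M           ∎
    where
    open ≡-Reasoning
    one ss : Fin (suc (suc d))
    one = suc zero
    ss  = suc (suc s)
    0≢s+1 : zero ≢ suc s
    0≢s+1 ()
    ss≢one : ss ≢ one
    ss≢one ()
    M₁ = swapRows one ss M
    M₂ = swapRows zero one M₁
    M₃ = swapRows one ss M₂
    sw₁ = swapRows-RowSwap ss≢one M
    sw₂ = swapRows-RowSwap {k = zero} {one} (λ ()) M₁
    sw₃ = swapRows-RowSwap ss≢one M₂

  det-swapRows : ∀ d → SwapNegatesDet d
  det-swapRows (suc d) {zero}  {zero}  0≢0 _  = ⊥-elim (0≢0 refl)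
  det-swapRows (suc d) {zero}  {suc s} _   sw = det-swap-topRow d (det-swapRows d) sw
  det-swapRows (suc d) {suc r} {zero}  _   sw = det-swap-topRow d (det-swapRows d) (RowSwap-sym sw)
  det-swapRows (suc d) {suc r} {suc s} r≢s sw = det-swap-lowerRows d (det-swapRows d) (r≢s ∘ cong suc) sw

  det-equalRows : ∀ d {r s : Fin d} {M : Matrix d} → r ≢ s → (∀ c → M r c ≡ M s c) → det M ≡ 0ℤ
  det-equalRows d {M = M} r≢s r≡s = self-negating (det-swapRows d r≢s self-swap)
    where
    self-swap = record { at-r = r≡s ; at-s = sym ∘ r≡s ; elsewhere = λ _ _ _ → refl }
    self-negating : ∀ {x} → x ≡ - x → x ≡ 0ℤ
    self-negating {+ zero}   _  = refl
    self-negating {+ suc _}  ()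
    self-negating { -[1+ _ ]} ()

  module _ {d} (k i : Fin d) (i≢k : i ≢ k) (M : Matrix d) where

    private
      C = λ x y u v → combineRows k i x y u v M

    det-combineRows-expandFirst : ∀ x y u v → det (C x y u v) ≡ x * det (C 1ℤ 0ℤ u v) + y * det (C 0ℤ 1ℤ u v)
    det-combineRows-expandFirst x y u v = det-linear d k x y (C x y u v) (C 1ℤ 0ℤ u v) (C 0ℤ 1ℤ u v) (off-k 1ℤ 0ℤ) (off-k 0ℤ 1ℤ) on-k
      where
      off-k : ∀ x′ y′ {t} → t ≢ k → ∀ c → C x y u v t c ≡ C x′ y′ u v t c
      off-k x′ y′ {t} t≢k c with rowCase k i t
      ... | first         = ⊥-elim (t≢k refl)
      ... | second _      = trans (combineRows-second k i x y u v M i≢k c) (sym (combineRows-second k i x′ y′ u v M i≢k c))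
      ... | other _ t≢i   = trans (combineRows-other k i x y u v M t≢k t≢i c) (sym (combineRows-other k i x′ y′ u v M t≢k t≢i c))
      on-k : ∀ c → C x y u v k c ≡ x * C 1ℤ 0ℤ u v k c + y * C 0ℤ 1ℤ u v k c
      on-k c = trans (combineRows-first k i x y u v M c) (trans
        (solve 4 (λ x y a b → x :* a :+ y :* b := x :* (con 1ℤ :* a :+ con 0ℤ :* b) :+ y :* (con 0ℤ :* a :+ con 1ℤ :* b)) refl x y (M k c) (M i c))
        (sym (cong₂ (λ p q → x * p + y * q) (combineRows-first k i 1ℤ 0ℤ u v M c) (combineRows-first k i 0ℤ 1ℤ u v M c))))

    det-combineRows-expandSecond : ∀ x y u v → det (C x y u v) ≡ u * det (C x y 1ℤ 0ℤ) + v * det (C x y 0ℤ 1ℤ)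
    det-combineRows-expandSecond x y u v = det-linear d i u v (C x y u v) (C x y 1ℤ 0ℤ) (C x y 0ℤ 1ℤ) (off-i 1ℤ 0ℤ) (off-i 0ℤ 1ℤ) on-i
      where
      off-i : ∀ u′ v′ {t} → t ≢ i → ∀ c → C x y u v t c ≡ C x y u′ v′ t c
      off-i u′ v′ {t} t≢i c with rowCase k i t
      ... | first         = trans (combineRows-first k i x y u v M c) (sym (combineRows-first k i x y u′ v′ M c))
      ... | second _      = ⊥-elim (t≢i refl)
      ... | other t≢k _   = trans (combineRows-other k i x y u v M t≢k t≢i c) (sym (combineRows-other k i x y u′ v′ M t≢k t≢i c))
      on-i : ∀ c → C x y u v i c ≡ u * C x y 1ℤ 0ℤ i c + v * C x y 0ℤ 1ℤ i c
      on-i c = trans (combineRows-second k i x y u v M i≢k c) (trans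
        (solve 4 (λ u v a b → u :* a :+ v :* b := u :* (con 1ℤ :* a :+ con 0ℤ :* b) :+ v :* (con 0ℤ :* a :+ con 1ℤ :* b)) refl u v (M k c) (M i c))
        (sym (cong₂ (λ p q → u * p + v * q) (combineRows-second k i x y 1ℤ 0ℤ M i≢k c) (combineRows-second k i x y 0ℤ 1ℤ M i≢k c))))

    det-combineRows-equalRows : ∀ x y → det (C x y x y) ≡ 0ℤ
    det-combineRows-equalRows x y = det-equalRows d (i≢k ∘ sym)
      (λ c → trans (combineRows-first k i x y x y M c) (sym (combineRows-second k i x y x y M i≢k c)))

    det-combineRows : ∀ x y u v → det (C x y u v) ≡ (x * v - y * u) * det M
    det-combineRows x y u v = begin
      det (C x y u v)
        ≡⟨ det-combineRows-expandFirst x y u v ⟩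
      x * det (C 1ℤ 0ℤ u v) + y * det (C 0ℤ 1ℤ u v)
        ≡⟨ cong₂ (λ p q → x * p + y * q) (det-combineRows-expandSecond 1ℤ 0ℤ u v) (det-combineRows-expandSecond 0ℤ 1ℤ u v) ⟩
      x * (u * det (C 1ℤ 0ℤ 1ℤ 0ℤ) + v * det (C 1ℤ 0ℤ 0ℤ 1ℤ)) + y * (u * det (C 0ℤ 1ℤ 1ℤ 0ℤ) + v * det (C 0ℤ 1ℤ 0ℤ 1ℤ))
        ≡⟨ cong₂ (λ p q → x * (u * p + v * det (C 1ℤ 0ℤ 0ℤ 1ℤ)) + y * (u * det (C 0ℤ 1ℤ 1ℤ 0ℤ) + v * q))
                 (det-combineRows-equalRows 1ℤ 0ℤ) (det-combineRows-equalRows 0ℤ 1ℤ) ⟩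
      x * (u * 0ℤ + v * det (C 1ℤ 0ℤ 0ℤ 1ℤ)) + y * (u * det (C 0ℤ 1ℤ 1ℤ 0ℤ) + v * 0ℤ)
        ≡⟨ cong₂ (λ p q → x * (u * 0ℤ + v * p) + y * (u * q + v * 0ℤ))
                 (det-cong d (combineRows-identity k i i≢k M)) (det-swapRows d (i≢k ∘ sym) (swapRows-RowSwap i≢k M)) ⟩
      x * (u * 0ℤ + v * det M) + y * (u * (- det M) + v * 0ℤ)
        ≡⟨ solve 5 (λ x y u v D → x :* (u :* con 0ℤ :+ v :* D) :+ y :* (u :* (:- D) :+ v :* con 0ℤ)
                               := (x :* v :- y :* u) :* D) refl x y u v (det M) ⟩
      (x * v - y * u) * det M ∎
      where open ≡-Reasoning

  det-negateRow : ∀ d (k : Fin d) (M : Matrix d) → det (negateRow k M) ≡ - det M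
  det-negateRow d k M = trans
    (det-linear d k (- 1ℤ) 0ℤ (negateRow k M) M M (negateRow-other k M) (negateRow-other k M)
      (λ c → trans (negateRow-row k M c) (solve 1 (λ a → :- a := (:- con 1ℤ) :* a :+ con 0ℤ :* a) refl (M k c))))
    (solve 1 (λ D → (:- con 1ℤ) :* D :+ con 0ℤ :* D := :- D) refl (det M))

  UpperTriangular : ∀ {d} → Matrix d → Set
  UpperTriangular M = ∀ r c → toℕ c ℕ.< toℕ r → M r c ≡ 0ℤ

  diagonalProduct : ∀ d → Matrix d → ℤ
  diagonalProduct zero    M = 1ℤ
  diagonalProduct (suc d) M = M zero zero * diagonalProduct d (λ r c → M (suc r) (suc c))

  det-firstColumnZero : ∀ d (M : Matrix (suc d)) → (∀ r → M r zero ≡ 0ℤ) → det M ≡ 0ℤ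

  laterTerm-zero : ∀ d (M : Matrix (suc d)) → (∀ r → M (suc r) zero ≡ 0ℤ) → ∀ j → term M (suc j) ≡ 0ℤ
  laterTerm-zero (suc d) M column≡0 j =
    trans (cong (sign (toℕ (suc j)) * M zero (suc j) *_) (det-firstColumnZero d (minor M (suc j)) column≡0))
          (*-zeroʳ (sign (toℕ (suc j)) * M zero (suc j)))

  det-firstColumnZero d M column≡0 = ∑-zero (suc d) (term M) termwise
    where
    termwise : ∀ j → term M j ≡ 0ℤ
    termwise zero    = trans (cong (λ m → sign 0 * m * det (minor M zero)) (column≡0 zero)) (*-zeroˡ (det (minor M zero)))
    termwise (suc j) = laterTerm-zero d M (column≡0 ∘ suc) j

  det-upperTriangular : ∀ d (M : Matrix d) → UpperTriangular M → det M ≡ diagonalProduct d M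
  det-upperTriangular zero    M upper = refl
  det-upperTriangular (suc d) M upper = begin
    term M zero + ∑ d (term M ∘ suc)
      ≡⟨ cong₂ _+_ (cong (sign 0 * M zero zero *_) (det-upperTriangular d (minor M zero) (λ r c c<r → upper (suc r) (suc c) (ℕ.s≤s c<r))))
                   (∑-zero d (term M ∘ suc) (laterTerm-zero d M (λ r → upper (suc r) zero (ℕ.s≤s ℕ.z≤n)))) ⟩
    sign 0 * M zero zero * diagonalProduct d (minor M zero) + 0ℤ
      ≡⟨ solve 2 (λ a p → con 1ℤ :* a :* p :+ con 0ℤ := a :* p) refl (M zero zero) (diagonalProduct d (minor M zero)) ⟩
    diagonalProduct (suc d) M ∎
    where open ≡-Reasoning

  diagonalProduct-zero : ∀ d (M : Matrix d) k → M k k ≡ 0ℤ → diagonalProduct d M ≡ 0ℤ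
  diagonalProduct-zero (suc d) M zero    Mkk≡0 = cong (_* diagonalProduct d (λ r c → M (suc r) (suc c))) Mkk≡0
  diagonalProduct-zero (suc d) M (suc k) Mkk≡0 =
    trans (cong (M zero zero *_) (diagonalProduct-zero d (λ r c → M (suc r) (suc c)) k Mkk≡0)) (*-zeroʳ (M zero zero))

  upperTriangular-diagonal≢0 : ∀ d (M : Matrix d) → UpperTriangular M → Nonsingular M → ∀ k → M k k ≢ 0ℤ
  upperTriangular-diagonal≢0 d M upper nonsingular k Mkk≡0 =
    nonsingular (trans (det-upperTriangular d M upper) (diagonalProduct-zero d M k Mkk≡0))

module ExtendedGcd where

  open import Data.Integer using (_+_; _*_; -_; _-_)
  open import Data.Integer.Properties using (pos-*; pos-+; neg-distribˡ-*; neg-distribʳ-*; *-cancelʳ-≡; *-identityˡ; +-identityˡ; ∣i∣≡0⇒i≡0)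
  import Data.Integer.DivMod as ℤ÷
  open import Data.Integer.Solver using (module +-*-Solver)
  open +-*-Solver
  open import Data.Nat.Divisibility using (_∣_; n∣m⇒m%n≡0; 0∣⇒≡0)
  open import Data.Nat.GCD using (module Bézout; GCD)

  gcdOf : ℤ → ℤ → ℕ
  gcdOf a b = proj₁ (egcd a b)

  bezoutˡ bezoutʳ : ℤ → ℤ → ℤ
  bezoutˡ a b = proj₁ (proj₂ (egcd a b))
  bezoutʳ a b = proj₂ (proj₂ (egcd a b))

  sgn*-* : ∀ a x → sgn* a x * a ≡ + (x ℕ.* ∣ a ∣)
  sgn*-* (+ n)    x = sym (pos-* x n)
  sgn*-* -[1+ n ] x = trans (sym (neg-distribˡ-* (+ x) -[1+ n ])) (trans (neg-distribʳ-* (+ x) -[1+ n ]) (sym (pos-* x (suc n))))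

  egcd-bezout : ∀ a b → bezoutˡ a b * a + bezoutʳ a b * b ≡ + gcdOf a b
  egcd-bezout a b with Bézout.lemma ∣ a ∣ ∣ b ∣
  ... | Bézout.result g _ (Bézout.+- x y g+yb≡xa) = begin
      sgn* a x * a + (- sgn* b y) * b        ≡⟨ cong₂ _+_ (sgn*-* a x) (trans (sym (neg-distribˡ-* (sgn* b y) b)) (cong -_ (sgn*-* b y))) ⟩
      + (x ℕ.* ∣ a ∣) - + (y ℕ.* ∣ b ∣)      ≡⟨ cong (λ n → + n - + (y ℕ.* ∣ b ∣)) (sym g+yb≡xa) ⟩
      + (g ℕ.+ y ℕ.* ∣ b ∣) - + (y ℕ.* ∣ b ∣) ≡⟨ cong (_- + (y ℕ.* ∣ b ∣)) (pos-+ g (y ℕ.* ∣ b ∣)) ⟩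
      + g + + (y ℕ.* ∣ b ∣) - + (y ℕ.* ∣ b ∣) ≡⟨ solve 2 (λ g n → g :+ n :- n := g) refl (+ g) (+ (y ℕ.* ∣ b ∣)) ⟩
      + g                                    ∎
    where open ≡-Reasoning
  ... | Bézout.result g _ (Bézout.-+ x y g+xa≡yb) = begin
      (- sgn* a x) * a + sgn* b y * b          ≡⟨ cong₂ _+_ (trans (sym (neg-distribˡ-* (sgn* a x) a)) (cong -_ (sgn*-* a x))) (sgn*-* b y) ⟩
      - + (x ℕ.* ∣ a ∣) + + (y ℕ.* ∣ b ∣)      ≡⟨ cong (λ n → - + (x ℕ.* ∣ a ∣) + + n) (sym g+xa≡yb) ⟩
      - + (x ℕ.* ∣ a ∣) + + (g ℕ.+ x ℕ.* ∣ a ∣) ≡⟨ cong (_+_ (- + (x ℕ.* ∣ a ∣))) (pos-+ g (x ℕ.* ∣ a ∣)) ⟩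
      - + (x ℕ.* ∣ a ∣) + (+ g + + (x ℕ.* ∣ a ∣)) ≡⟨ solve 2 (λ g n → :- n :+ (g :+ n) := g) refl (+ g) (+ (x ℕ.* ∣ a ∣)) ⟩
      + g                                        ∎
    where open ≡-Reasoning

  egcd-isGCD : ∀ a b → GCD ∣ a ∣ ∣ b ∣ (gcdOf a b)
  egcd-isGCD a b with Bézout.lemma ∣ a ∣ ∣ b ∣
  ... | Bézout.result g isGCD (Bézout.+- _ _ _) = isGCD
  ... | Bézout.result g isGCD (Bézout.-+ _ _ _) = isGCD

  divN-exact : ∀ a g → g ∣ ∣ a ∣ → g ≢ 0 → divN a g * + g ≡ a
  divN-exact a zero    _   0≢0 = ⊥-elim (0≢0 refl)
  divN-exact a (suc g) g∣a _   = sym (begin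
    a                                           ≡⟨ ℤ÷.a≡a%ℕn+[a/ℕn]*n a (suc g) ⟩
    + (a ℤ÷.%ℕ suc g) + (a ℤ÷./ℕ suc g) * + suc g ≡⟨ cong (λ r → + r + (a ℤ÷./ℕ suc g) * + suc g) (remainder-zero a (n∣m⇒m%n≡0 ∣ a ∣ (suc g) g∣a)) ⟩
    0ℤ + (a ℤ÷./ℕ suc g) * + suc g               ≡⟨ +-identityˡ _ ⟩
    (a ℤ÷./ℕ suc g) * + suc g                    ∎)
    where
    open ≡-Reasoning
    remainder-zero : ∀ a → ∣ a ∣ ℕ.% suc g ≡ 0 → a ℤ÷.%ℕ suc g ≡ 0
    remainder-zero (+ n)    n%g≡0 = n%g≡0
    remainder-zero -[1+ n ] n%g≡0 with suc n ℕ.% suc g | n%g≡0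
    ... | zero | _ = refl

  gcdOf≢0 : ∀ a b → b ≢ 0ℤ → gcdOf a b ≢ 0
  gcdOf≢0 a b b≢0 g≡0 =
    b≢0 (∣i∣≡0⇒i≡0 (0∣⇒≡0 (subst (_∣ ∣ b ∣) g≡0 (proj₂ (GCD.commonDivisor (egcd-isGCD a b))))))

  module _ (a b : ℤ) (b≢0 : b ≢ 0ℤ) where

    private
      g = gcdOf a b
      x = bezoutˡ a b
      y = bezoutʳ a b
      a/g*g≡a : divN a g * + g ≡ a
      a/g*g≡a = divN-exact a g (proj₁ (GCD.commonDivisor (egcd-isGCD a b))) (gcdOf≢0 a b b≢0)
      b/g*g≡b : divN b g * + g ≡ b
      b/g*g≡b = divN-exact b g (proj₂ (GCD.commonDivisor (egcd-isGCD a b))) (gcdOf≢0 a b b≢0)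

    elimination-unimodular : x * divN a g - y * (- divN b g) ≡ 1ℤ
    elimination-unimodular = cancel g (gcdOf≢0 a b b≢0) (begin
      (x * divN a g - y * (- divN b g)) * + g
        ≡⟨ solve 5 (λ x y A B g → (x :* A :- y :* (:- B)) :* g := x :* (A :* g) :+ y :* (B :* g)) refl x y (divN a g) (divN b g) (+ g) ⟩
      x * (divN a g * + g) + y * (divN b g * + g) ≡⟨ cong₂ (λ p q → x * p + y * q) a/g*g≡a b/g*g≡b ⟩
      x * a + y * b                             ≡⟨ egcd-bezout a b ⟩
      + g                                       ≡⟨ sym (*-identityˡ (+ g)) ⟩
      1ℤ * + g                                  ∎)
      where
      open ≡-Reasoning
      cancel : ∀ n → n ≢ 0 → ∀ {p} → p * + n ≡ 1ℤ * + n → p ≡ 1ℤ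
      cancel zero    0≢0 _  = ⊥-elim (0≢0 refl)
      cancel (suc n) _   eq = *-cancelʳ-≡ _ 1ℤ (+ suc n) eq

    elimination-clears : (- divN b g) * a + divN a g * b ≡ 0ℤ
    elimination-clears = begin
      (- divN b g) * a + divN a g * b                           ≡⟨ cong₂ (λ p q → (- divN b g) * p + divN a g * q) (sym a/g*g≡a) (sym b/g*g≡b) ⟩
      (- divN b g) * (divN a g * + g) + divN a g * (divN b g * + g)
        ≡⟨ solve 3 (λ A B g → (:- B) :* (A :* g) :+ A :* (B :* g) := con 0ℤ) refl (divN a g) (divN b g) (+ g) ⟩
      0ℤ                                                        ∎
      where open ≡-Reasoning

module HermiteAlgorithm where

  open Folds
  open Matrices
  open RowOperations
  open Determinants
  open ExtendedGcd
  open import Data.Integer using (_+_; _*_; -_; _-_; _≤_; _<_)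
  open import Data.Integer.Properties using (∣-i∣≡∣i∣; *-identityˡ)
  import Data.Integer.Properties as ℤₚ
  import Data.Integer.DivMod as ℤ÷
  open import Data.Integer.Solver using (module +-*-Solver)
  open +-*-Solver
  open import Data.List using (foldl; allFin; tabulate)
  open import Data.List.Membership.Propositional using (_∈_)
  open import Data.List.Membership.Propositional.Properties using (∈-filter⁺; ∈-filter⁻; ∈-allFin)
  open import Relation.Nullary.Decidable using (T?)

  _↝_ : ∀ {d} → Matrix d → Matrix d → Set
  M ↝ N = RowEquivalent M N × ∣ det N ∣ ≡ ∣ det M ∣

  ↝-refl : ∀ {d} {M : Matrix d} → M ↝ M
  ↝-refl = RowEquivalent-reflexive ≈M-refl , refl

  ↝-trans : ∀ {d} {M N P : Matrix d} → M ↝ N → N ↝ P → M ↝ P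
  ↝-trans (M~N , ∣N∣≡∣M∣) (N~P , ∣P∣≡∣N∣) = RowEquivalent-trans M~N N~P , trans ∣P∣≡∣N∣ ∣N∣≡∣M∣

  ↝-respʳ : ∀ {d} {M N N′ : Matrix d} → M ↝ N → N ≈M N′ → M ↝ N′
  ↝-respʳ {d} (M~N , ∣N∣≡∣M∣) N≈N′ = RowEquivalent-respʳ M~N N≈N′ , trans (cong ∣_∣ (sym (det-cong d N≈N′))) ∣N∣≡∣M∣

  combineRows-↝ : ∀ {d} (k i : Fin d) x y u v → i ≢ k → x * v - y * u ≡ 1ℤ → (M : Matrix d) → M ↝ combineRows k i x y u v M
  combineRows-↝ k i x y u v i≢k det≡1 M = combineRows-RowEquivalent k i x y u v i≢k det≡1 M ,
    cong ∣_∣ (trans (det-combineRows k i i≢k M x y u v) (trans (cong (_* det M) det≡1) (*-identityˡ (det M))))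

  negateRow-↝ : ∀ {d} (k : Fin d) (M : Matrix d) → M ↝ negateRow k M
  negateRow-↝ {d} k M = negateRow-RowEquivalent k M , trans (cong ∣_∣ (det-negateRow d k M)) (∣-i∣≡∣i∣ (det M))

  TriangularBefore : ∀ {d} → ℕ → Matrix d → Set
  TriangularBefore m M = ∀ {r c} → toℕ c ℕ.< m → toℕ c ℕ.< toℕ r → M r c ≡ 0ℤ

  isZero-true : ∀ {x} → isZero x ≡ true → x ≡ 0ℤ
  isZero-true {x} eq with x ℤ.≟ 0ℤ
  ... | yes x≡0 = x≡0

  isZero-false : ∀ {x} → isZero x ≡ false → x ≢ 0ℤ
  isZero-false {x} eq with x ℤ.≟ 0ℤ
  ... | no x≢0 = x≢0

  <⇒≢ : ∀ {d} {i j : Fin d} → toℕ i ℕ.< toℕ j → i ≢ j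
  <⇒≢ i<j refl = ℕₚ.<-irrefl refl i<j

  module _ {d} (k : Fin d) where

    record ColumnElimination (M M′ : Matrix d) : Set where
      field
        reduces     : M ↝ M′
        keeps-left  : ∀ r {c} → toℕ c ℕ.< toℕ k → M′ r c ≡ M r c
        keeps-zeros : ∀ {i} → i ≢ k → M i k ≡ 0ℤ → M′ i k ≡ 0ℤ

    eliminate-step : ∀ {st : Costed (Matrix d)} {i} → toℕ k ℕ.< toℕ i → TriangularBefore (toℕ k) (proj₁ st) →
      ColumnElimination (proj₁ st) (proj₁ (eliminate k st i)) × proj₁ (eliminate k st i) i k ≡ 0ℤ
    eliminate-step {M , _} {i} k<i triangular with isZero (M i k) in eq
    ... | true  = record { reduces = ↝-refl ; keeps-left = λ _ _ → refl ; keeps-zeros = λ _ z → z } , isZero-true eq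
    ... | false = record { reduces = combineRows-↝ k i x y u v i≢k (elimination-unimodular a b b≢0) M
                         ; keeps-left = keeps-left ; keeps-zeros = keeps-zeros } , clears
      where
      a = M k k
      b = M i k
      b≢0 = isZero-false eq
      g = gcdOf a b
      x = bezoutˡ a b
      y = bezoutʳ a b
      u = - divN b g
      v = divN a g
      i≢k = <⇒≢ k<i ∘ sym
      M′ = combineRows k i x y u v M
      clears : M′ i k ≡ 0ℤ
      clears = trans (combineRows-second k i x y u v M i≢k k) (elimination-clears a b b≢0)
      zero-combination : ∀ {c} p q → toℕ c ℕ.< toℕ k → p * M k c + q * M i c ≡ 0ℤ
      zero-combination p q c<k = trans (cong₂ (λ m n → p * m + q * n) (triangular c<k c<k) (triangular c<k (ℕₚ.<-trans c<k k<i)))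
                                       (solve 2 (λ p q → p :* con 0ℤ :+ q :* con 0ℤ := con 0ℤ) refl p q)
      keeps-left : ∀ r {c} → toℕ c ℕ.< toℕ k → M′ r c ≡ M r c
      keeps-left r {c} c<k with rowCase k i r
      ... | first         = trans (combineRows-first k i x y u v M c) (trans (zero-combination x y c<k) (sym (triangular c<k c<k)))
      ... | second _      = trans (combineRows-second k i x y u v M i≢k c) (trans (zero-combination u v c<k) (sym (triangular c<k (ℕₚ.<-trans c<k k<i))))
      ... | other r≢k r≢i = combineRows-other k i x y u v M r≢k r≢i c
      keeps-zeros : ∀ {j} → j ≢ k → M j k ≡ 0ℤ → M′ j k ≡ 0ℤ
      keeps-zeros {j} j≢k Mjk≡0 with rowCase k i j
      ... | first         = ⊥-elim (j≢k refl)
      ... | second _      = clears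
      ... | other j≢k j≢i = trans (combineRows-other k i x y u v M j≢k j≢i k) Mjk≡0

    ColumnElimination-refl : ∀ {M} → ColumnElimination M M
    ColumnElimination-refl = record { reduces = ↝-refl ; keeps-left = λ _ _ → refl ; keeps-zeros = λ _ z → z }

    ColumnElimination-trans : ∀ {M N P} → ColumnElimination M N → ColumnElimination N P → ColumnElimination M P
    ColumnElimination-trans M→N N→P = record
      { reduces     = ↝-trans (reduces M→N) (reduces N→P)
      ; keeps-left  = λ r c<k → trans (keeps-left N→P r c<k) (keeps-left M→N r c<k)
      ; keeps-zeros = λ i≢k z → keeps-zeros N→P i≢k (keeps-zeros M→N i≢k z)
      }
      where open ColumnElimination

    ∈-below⁻ : ∀ {i} → i ∈ below k → toℕ k ℕ.< toℕ i
    ∈-below⁻ i∈ = ℕₚ.<ᵇ⇒< (toℕ k) _ (proj₂ (∈-filter⁻ (T? ∘ (λ j → toℕ k ℕ.<ᵇ toℕ j)) {xs = allFin d} i∈))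

    ∈-below⁺ : ∀ {i} → toℕ k ℕ.< toℕ i → i ∈ below k
    ∈-below⁺ {i} k<i = ∈-filter⁺ (T? ∘ (λ j → toℕ k ℕ.<ᵇ toℕ j)) (∈-allFin i) (ℕₚ.<⇒<ᵇ k<i)

    ∈-above⁻ : ∀ {i} → i ∈ above k → toℕ i ℕ.< toℕ k
    ∈-above⁻ i∈ = ℕₚ.<ᵇ⇒< _ (toℕ k) (proj₂ (∈-filter⁻ (T? ∘ (λ j → toℕ j ℕ.<ᵇ toℕ k)) {xs = allFin d} i∈))

    ∈-above⁺ : ∀ {i} → toℕ i ℕ.< toℕ k → i ∈ above k
    ∈-above⁺ {i} i<k = ∈-filter⁺ (T? ∘ (λ j → toℕ j ℕ.<ᵇ toℕ k)) (∈-allFin i) (ℕₚ.<⇒<ᵇ i<k)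

    eliminate-below : ∀ (st : Costed (Matrix d)) → TriangularBefore (toℕ k) (proj₁ st) →
      ColumnElimination (proj₁ st) (proj₁ (foldl (eliminate k) st (below k))) ×
      (∀ {i} → toℕ k ℕ.< toℕ i → proj₁ (foldl (eliminate k) st (below k)) i k ≡ 0ℤ)
    eliminate-below st triangular with sweep (below k) st ∈-below⁻ triangular
      where
      sweep = foldl-sweep (eliminate k) (λ i → toℕ k ℕ.< toℕ i) (TriangularBefore (toℕ k) ∘ proj₁)
        (λ st st′ → ColumnElimination (proj₁ st) (proj₁ st′)) (λ i st → proj₁ st i k ≡ 0ℤ)
        ColumnElimination-refl ColumnElimination-trans
        (λ st→st′ triangular c<k c<r → trans (ColumnElimination.keeps-left st→st′ _ c<k) (triangular c<k c<r))
        eliminate-step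
        (λ k<i st→st′ → ColumnElimination.keeps-zeros st→st′ (<⇒≢ k<i ∘ sym))
    ... | elimination , cleared = elimination , cleared ∘ ∈-below⁺

    record SignFix (M M′ : Matrix d) : Set where
      field
        reduces          : M ↝ M′
        keeps-other-rows : ∀ {r} → r ≢ k → ∀ c → M′ r c ≡ M r c
        pivot-nonneg     : 0ℤ ≤ M′ k k
        keeps-row-zeros  : ∀ {c} → M k c ≡ 0ℤ → M′ k c ≡ 0ℤ

    fixSign-step : ∀ (st : Costed (Matrix d)) → SignFix (proj₁ st) (proj₁ (fixSign k st))
    fixSign-step (M , _) with isNeg (M k k) in eq
    ... | true  = record
      { reduces          = negateRow-↝ k M
      ; keeps-other-rows = negateRow-other k M
      ; pivot-nonneg     = subst (0ℤ ≤_) (sym (negateRow-row k M k)) (neg-nonneg (M k k) eq)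
      ; keeps-row-zeros  = λ {c} Mkc≡0 → trans (negateRow-row k M c) (cong -_ Mkc≡0)
      }
      where
      neg-nonneg : ∀ x → isNeg x ≡ true → 0ℤ ≤ - x
      neg-nonneg -[1+ n ] _ = ℤ.+≤+ ℕ.z≤n
    ... | false = record
      { reduces = ↝-refl ; keeps-other-rows = λ _ _ → refl ; pivot-nonneg = nonneg (M k k) eq ; keeps-row-zeros = id }
      where
      nonneg : ∀ x → isNeg x ≡ false → 0ℤ ≤ x
      nonneg (+ n) _ = ℤ.+≤+ ℕ.z≤n

  subtractPivotMultiple : ∀ {d} → Fin d → Fin d → ℤ → Matrix d → Matrix d
  subtractPivotMultiple k i q M r c = if ⌊ r Fin.≟ i ⌋ then M i c - q * M k c else M r c

  module _ {d} (k i : Fin d) (q : ℤ) (M : Matrix d) where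

    subtractPivotMultiple-row : ∀ c → subtractPivotMultiple k i q M i c ≡ M i c - q * M k c
    subtractPivotMultiple-row c with i Fin.≟ i
    ... | yes _  = refl
    ... | no i≢i = ⊥-elim (i≢i refl)

    subtractPivotMultiple-other : ∀ {r} → r ≢ i → ∀ c → subtractPivotMultiple k i q M r c ≡ M r c
    subtractPivotMultiple-other {r} r≢i c with r Fin.≟ i
    ... | yes r≡i = ⊥-elim (r≢i r≡i)
    ... | no _    = refl

    subtractPivotMultiple-↝ : i ≢ k → M ↝ subtractPivotMultiple k i q M
    subtractPivotMultiple-↝ i≢k = ↝-respʳ (combineRows-↝ k i 1ℤ 0ℤ (- q) 1ℤ i≢k refl M) same
      where
      same : combineRows k i 1ℤ 0ℤ (- q) 1ℤ M ≈M subtractPivotMultiple k i q M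
      same r c with rowCase k i r
      ... | first = trans (combineRows-first k i 1ℤ 0ℤ (- q) 1ℤ M c)
        (trans (solve 2 (λ a b → con 1ℤ :* a :+ con 0ℤ :* b := a) refl (M k c) (M i c)) (sym (subtractPivotMultiple-other (i≢k ∘ sym) c)))
      ... | second _ = trans (combineRows-second k i 1ℤ 0ℤ (- q) 1ℤ M i≢k c)
        (trans (solve 3 (λ q a b → (:- q) :* a :+ con 1ℤ :* b := b :- q :* a) refl q (M k c) (M i c)) (sym (subtractPivotMultiple-row c)))
      ... | other r≢k r≢i = trans (combineRows-other k i 1ℤ 0ℤ (- q) 1ℤ M r≢k r≢i c) (sym (subtractPivotMultiple-other r≢i c))

  module _ {d} (k : Fin d) where

    ReducedEntry : Matrix d → Fin d → Set
    ReducedEntry M i = 0ℤ < M k k → 0ℤ ≤ M i k × M i k < M k k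

    RowZeroBefore : Matrix d → Set
    RowZeroBefore M = ∀ {c} → toℕ c ℕ.< toℕ k → M k c ≡ 0ℤ

    record RowReduction (M M′ : Matrix d) : Set where
      field
        reduces       : M ↝ M′
        keeps-lower   : ∀ {r} → toℕ k ℕ.≤ toℕ r → ∀ c → M′ r c ≡ M r c
        keeps-left    : ∀ r {c} → toℕ c ℕ.< toℕ k → M′ r c ≡ M r c
        keeps-reduced : ∀ {i} → ReducedEntry M i → ReducedEntry M′ i

    RowReduction-refl : ∀ {M} → RowReduction M M
    RowReduction-refl = record
      { reduces = ↝-refl ; keeps-lower = λ _ _ → refl ; keeps-left = λ _ _ → refl ; keeps-reduced = id }

    RowReduction-trans : ∀ {M N P} → RowReduction M N → RowReduction N P → RowReduction M P
    RowReduction-trans M→N N→P = record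
      { reduces       = ↝-trans (reduces M→N) (reduces N→P)
      ; keeps-lower   = λ k≤r c → trans (keeps-lower N→P k≤r c) (keeps-lower M→N k≤r c)
      ; keeps-left    = λ r c<k → trans (keeps-left N→P r c<k) (keeps-left M→N r c<k)
      ; keeps-reduced = keeps-reduced N→P ∘ keeps-reduced M→N
      }
      where open RowReduction

    ReducedEntry-resp : ∀ {M M′ i} → M′ k k ≡ M k k → M′ i k ≡ M i k → ReducedEntry M i → ReducedEntry M′ i
    ReducedEntry-resp {i = i} kk ik reduced 0<M′kk with reduced (subst (0ℤ <_) kk 0<M′kk)
    ... | 0≤Mik , Mik<Mkk = subst (0ℤ ≤_) (sym ik) 0≤Mik , subst₂ _<_ (sym ik) (sym kk) Mik<Mkk

    reduce-step : ∀ {st : Costed (Matrix d)} {i} → toℕ i ℕ.< toℕ k → RowZeroBefore (proj₁ st) →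
      RowReduction (proj₁ st) (proj₁ (reduce k st i)) × ReducedEntry (proj₁ (reduce k st i)) i
    reduce-step {M , _} {i} i<k row-zero with M k k in eq
    ... | + zero    = RowReduction-refl , λ 0<Mkk → ⊥-elim (ℤₚ.<-irrefl refl (subst (0ℤ <_) eq 0<Mkk))
    ... | -[1+ n ]  = RowReduction-refl , λ 0<Mkk → ⊥-elim (ℤₚ.<-asym (subst (0ℤ <_) eq 0<Mkk) ℤ.-<+)
    ... | + suc p   = record
      { reduces       = subtractPivotMultiple-↝ k i q M i≢k
      ; keeps-lower   = λ k≤r → subtractPivotMultiple-other k i q M (λ r≡i → ℕₚ.<⇒≱ i<k (subst (λ r → toℕ k ℕ.≤ toℕ r) r≡i k≤r))
      ; keeps-left    = keeps-left
      ; keeps-reduced = keeps-reduced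
      } , reduced
      where
      q  = M i k ℤ./ℕ suc p
      M′ = subtractPivotMultiple k i q M
      i≢k = <⇒≢ i<k
      pivot : M′ k k ≡ + suc p
      pivot = trans (subtractPivotMultiple-other k i q M (i≢k ∘ sym) k) eq
      remainder : M′ i k ≡ + (M i k ℤ÷.%ℕ suc p)
      remainder = begin
        M′ i k                                                  ≡⟨ subtractPivotMultiple-row k i q M k ⟩
        M i k - q * M k k                                       ≡⟨ cong (λ x → M i k - q * x) eq ⟩
        M i k - q * + suc p                                     ≡⟨ cong (λ x → x - q * + suc p) (ℤ÷.a≡a%ℕn+[a/ℕn]*n (M i k) (suc p)) ⟩
        + (M i k ℤ÷.%ℕ suc p) + q * + suc p - q * + suc p       ≡⟨ solve 2 (λ r s → r :+ s :- s := r) refl (+ (M i k ℤ÷.%ℕ suc p)) (q * + suc p) ⟩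
        + (M i k ℤ÷.%ℕ suc p)                                   ∎
        where open ≡-Reasoning
      reduced : ReducedEntry M′ i
      reduced _ = subst (0ℤ ≤_) (sym remainder) (ℤ.+≤+ ℕ.z≤n) ,
                  subst₂ _<_ (sym remainder) (sym pivot) (ℤ.+<+ (ℤ÷.n%ℕd<d (M i k) (suc p)))
      keeps-left : ∀ r {c} → toℕ c ℕ.< toℕ k → M′ r c ≡ M r c
      keeps-left r {c} c<k with toSum (r Fin.≟ i)
      ... | inj₁ refl = trans (subtractPivotMultiple-row k i q M c)
          (trans (cong (λ x → M i c - q * x) (row-zero c<k)) (solve 2 (λ a q → a :- q :* con 0ℤ := a) refl (M i c) q))
      ... | inj₂ r≢i = subtractPivotMultiple-other k i q M r≢i c
      keeps-reduced : ∀ {j} → ReducedEntry M j → ReducedEntry M′ j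
      keeps-reduced {j} reduced-j with toSum (j Fin.≟ i)
      ... | inj₁ refl = reduced
      ... | inj₂ j≢i = ReducedEntry-resp {M} {M′} {j} (subtractPivotMultiple-other k i q M (i≢k ∘ sym) k)
                                         (subtractPivotMultiple-other k i q M j≢i k) reduced-j

    reduce-above : ∀ (st : Costed (Matrix d)) → RowZeroBefore (proj₁ st) →
      RowReduction (proj₁ st) (proj₁ (foldl (reduce k) st (above k))) ×
      (∀ {i} → toℕ i ℕ.< toℕ k → ReducedEntry (proj₁ (foldl (reduce k) st (above k))) i)
    reduce-above st row-zero with sweep (above k) st (∈-above⁻ k) row-zero
      where
      sweep = foldl-sweep (reduce k) (λ i → toℕ i ℕ.< toℕ k) (RowZeroBefore ∘ proj₁)
        (λ st st′ → RowReduction (proj₁ st) (proj₁ st′)) (λ i st → ReducedEntry (proj₁ st) i)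
        RowReduction-refl RowReduction-trans
        (λ st→st′ row-zero c<k → trans (RowReduction.keeps-lower st→st′ ℕₚ.≤-refl _) (row-zero c<k))
        reduce-step
        (λ _ st→st′ → RowReduction.keeps-reduced st→st′)
    ... | reduction , reduced = reduction , reduced ∘ ∈-above⁺ k

  record HermiteUpTo {d} (m : ℕ) (H : Matrix d) : Set where
    field
      zero-below      : TriangularBefore m H
      diagonal-nonneg : ∀ {c} → toℕ c ℕ.< m → 0ℤ ≤ H c c
      reduced-above   : ∀ {r c} → toℕ c ℕ.< m → toℕ r ℕ.< toℕ c → ReducedEntry c H r

  column-split : ∀ {d} {c k : Fin d} → toℕ c ℕ.< suc (toℕ k) → toℕ c ℕ.< toℕ k ⊎ c ≡ k
  column-split c<1+k with ℕₚ.m<1+n⇒m<n∨m≡n c<1+k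
  ... | inj₁ c<k = inj₁ c<k
  ... | inj₂ c≡k = inj₂ (Finₚ.toℕ-injective c≡k)

  module _ {d} (k : Fin d) (st : Costed (Matrix d)) (hermite : HermiteUpTo (toℕ k) (proj₁ st)) where

    private
      open HermiteUpTo hermite
      M  = proj₁ st
      st₁ = foldl (eliminate k) st (below k)
      st₂ = fixSign k st₁
      M₁ = proj₁ st₁
      M₂ = proj₁ st₂
      M₃ = proj₁ (processColumn st k)
      elimination = proj₁ (eliminate-below k st zero-below)
      cleared     = proj₂ (eliminate-below k st zero-below)
      signFix     = fixSign-step k st₁
      row-zero₁ : RowZeroBefore k M₁
      row-zero₁ c<k = trans (ColumnElimination.keeps-left elimination k c<k) (zero-below c<k c<k)
      row-zero₂ : RowZeroBefore k M₂
      row-zero₂ c<k = SignFix.keeps-row-zeros signFix (row-zero₁ c<k)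
      reduction = proj₁ (reduce-above k st₂ row-zero₂)
      reduced   = proj₂ (reduce-above k st₂ row-zero₂)

    processColumn-↝ : M ↝ M₃
    processColumn-↝ = ↝-trans (ColumnElimination.reduces elimination)
                        (↝-trans (SignFix.reduces signFix) (RowReduction.reduces reduction))

    processColumn-keeps-left : ∀ r {c} → toℕ c ℕ.< toℕ k → M₃ r c ≡ M r c
    processColumn-keeps-left r {c} c<k =
      trans (RowReduction.keeps-left reduction r c<k) (trans (signFix-keeps-left r) (ColumnElimination.keeps-left elimination r c<k))
      where
      signFix-keeps-left : ∀ r → M₂ r c ≡ M₁ r c
      signFix-keeps-left r with toSum (r Fin.≟ k)
      ... | inj₁ refl = trans (row-zero₂ c<k) (sym (row-zero₁ c<k))
      ... | inj₂ r≢k  = SignFix.keeps-other-rows signFix r≢k _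

    processColumn-hermite : HermiteUpTo (suc (toℕ k)) M₃
    processColumn-hermite = record
      { zero-below      = zero-below′
      ; diagonal-nonneg = diagonal-nonneg′
      ; reduced-above   = reduced-above′
      }
      where
      zero-below′ : TriangularBefore (suc (toℕ k)) M₃
      zero-below′ {r} c<1+k c<r with column-split c<1+k
      ... | inj₁ c<k  = trans (processColumn-keeps-left r c<k) (zero-below c<k c<r)
      ... | inj₂ refl = trans (RowReduction.keeps-lower reduction (ℕₚ.<⇒≤ c<r) k)
                          (trans (SignFix.keeps-other-rows signFix (<⇒≢ c<r ∘ sym) k) (cleared c<r))
      diagonal-nonneg′ : ∀ {c} → toℕ c ℕ.< suc (toℕ k) → 0ℤ ≤ M₃ c c
      diagonal-nonneg′ c<1+k with column-split c<1+k
      ... | inj₁ c<k  = subst (0ℤ ≤_) (sym (processColumn-keeps-left _ c<k)) (diagonal-nonneg c<k)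
      ... | inj₂ refl = subst (0ℤ ≤_) (sym (RowReduction.keeps-lower reduction ℕₚ.≤-refl k)) (SignFix.pivot-nonneg signFix)
      reduced-above′ : ∀ {r c} → toℕ c ℕ.< suc (toℕ k) → toℕ r ℕ.< toℕ c → ReducedEntry c M₃ r
      reduced-above′ {r} c<1+k r<c with column-split c<1+k
      ... | inj₁ c<k  = ReducedEntry-resp _ {M} {M₃} {r} (processColumn-keeps-left _ c<k) (processColumn-keeps-left r c<k)
                          (reduced-above c<k r<c)
      ... | inj₂ refl = reduced r<c

  processColumns : ∀ {d} n (g : Fin n → Fin d) m → (∀ i → toℕ (g i) ≡ m ℕ.+ toℕ i) →
    ∀ (st : Costed (Matrix d)) → HermiteUpTo m (proj₁ st) →
    proj₁ st ↝ proj₁ (foldl processColumn st (tabulate g)) × HermiteUpTo (m ℕ.+ n) (proj₁ (foldl processColumn st (tabulate g)))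
  processColumns zero    g m _       st hermite = ↝-refl , subst (λ m → HermiteUpTo m (proj₁ st)) (sym (ℕₚ.+-identityʳ m)) hermite
  processColumns (suc n) g m g-index st hermite =
    ↝-trans (proj₁ head) (proj₁ rest) , subst (λ m → HermiteUpTo m end) (sym (ℕₚ.+-suc m n)) (proj₂ rest)
    where
    g₀ : toℕ (g zero) ≡ m
    g₀ = trans (g-index zero) (ℕₚ.+-identityʳ m)
    next = proj₁ (processColumn st (g zero))
    end  = proj₁ (foldl processColumn (processColumn st (g zero)) (tabulate (g ∘ suc)))
    head : proj₁ st ↝ next × HermiteUpTo (suc (toℕ (g zero))) next
    head = processColumn-↝ (g zero) st hermite₀ , processColumn-hermite (g zero) st hermite₀
      where hermite₀ = subst (λ m → HermiteUpTo m (proj₁ st)) (sym g₀) hermite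
    rest : next ↝ end × HermiteUpTo (suc m ℕ.+ n) end
    rest = processColumns n (g ∘ suc) (suc m) (λ i → trans (g-index (suc i)) (ℕₚ.+-suc m (toℕ i)))
             (processColumn st (g zero)) (subst (λ m → HermiteUpTo m next) (cong suc g₀) (proj₂ head))

  hnf-invariant : ∀ {d} (M : Matrix d) → M ↝ H M × HermiteUpTo d (H M)
  hnf-invariant {d} M = processColumns d id 0 (λ _ → refl) (M , 0) record
    { zero-below = λ () ; diagonal-nonneg = λ () ; reduced-above = λ () }

  hnf-RowEquivalent : ∀ {d} (M : Matrix d) → RowEquivalent M (H M)
  hnf-RowEquivalent M = proj₁ (proj₁ (hnf-invariant M))

  hnf-hermite : ∀ {d} (M : Matrix d) → HermiteUpTo d (H M)
  hnf-hermite M = proj₂ (hnf-invariant M)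

  IsHNF : ∀ {d} → Matrix d → Set
  IsHNF {d} H = HermiteUpTo d H × (∀ c → 0ℤ < H c c)

  HermiteUpTo-upperTriangular : ∀ {d} {H : Matrix d} → HermiteUpTo d H → UpperTriangular H
  HermiteUpTo-upperTriangular hermite r c c<r = HermiteUpTo.zero-below hermite (Finₚ.toℕ<n c) c<r

  hnf-isHNF : ∀ {d} (M : Matrix d) → Nonsingular M → IsHNF (H M)
  hnf-isHNF {d} M nonsingular = hermite , λ c → ℤₚ.≤∧≢⇒< (HermiteUpTo.diagonal-nonneg hermite (Finₚ.toℕ<n c)) (≢0 c ∘ sym)
    where
    hermite = proj₂ (hnf-invariant M)
    ∣det∣-preserved = proj₂ (proj₁ (hnf-invariant M))
    ≢0 : ∀ c → H M c c ≢ 0ℤ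
    ≢0 = upperTriangular-diagonal≢0 d (H M) (HermiteUpTo-upperTriangular hermite)
           (λ det≡0 → nonsingular (ℤₚ.∣i∣≡0⇒i≡0 (trans (sym ∣det∣-preserved) (cong ∣_∣ det≡0))))

module HermiteUniqueness where

  open Sums
  open Matrices
  open Determinants using (UpperTriangular)
  open HermiteAlgorithm using (HermiteUpTo; IsHNF; HermiteUpTo-upperTriangular)
  open import Data.Integer using (_+_; _*_; -_; _-_; _≤_; _<_)
  open import Data.Integer.Properties
  open import Data.Integer.Solver using (module +-*-Solver)
  open +-*-Solver
  open import Relation.Binary.Definitions using (tri<; tri≈; tri>)

  *M-column : ∀ {d} (U H : Matrix d) (c : Fin d) → UpperTriangular H → (∀ {j} → toℕ j ℕ.< toℕ c → ∀ r → U r j ≡ I r j) →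
    ∀ r → (U *M H) r c ≡ H r c + (U r c - I r c) * H c c
  *M-column {d} U H c upper U≡I r = begin
    ∑ d (λ j → U r j * H j c)                        ≡⟨ ∑-cong d termwise ⟩
    ∑ d (λ j → I r j * H j c + I j c * X)            ≡⟨ ∑-distrib-+ d _ _ ⟩
    (I *M H) r c + ∑ d (λ j → I j c * X)
      ≡⟨ cong₂ _+_ (*M-identityˡ H r c) (∑-single d _ c (λ j j≢c → trans (cong (_* X) (I-offDiagonal j≢c)) (*-zeroˡ X))) ⟩
    H r c + I c c * X                                ≡⟨ cong (λ e → H r c + e * X) (I-diagonal c) ⟩
    H r c + 1ℤ * X                                   ≡⟨ cong (_+_ (H r c)) (*-identityˡ X) ⟩
    H r c + X                                        ∎
    where
    open ≡-Reasoning
    X = (U r c - I r c) * H c c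
    termwise : ∀ j → U r j * H j c ≡ I r j * H j c + I j c * X
    termwise j with ℕₚ.<-cmp (toℕ j) (toℕ c)
    ... | tri< j<c _ _ = begin
      U r j * H j c              ≡⟨ cong (_* H j c) (U≡I j<c r) ⟩
      I r j * H j c              ≡⟨ sym (+-identityʳ _) ⟩
      I r j * H j c + 0ℤ         ≡⟨ cong (_+_ (I r j * H j c)) (sym (trans (cong (_* X) (I-offDiagonal (j<c→≢ j<c))) (*-zeroˡ X))) ⟩
      I r j * H j c + I j c * X  ∎
      where j<c→≢ = λ j<c j≡c → ℕₚ.<-irrefl (cong toℕ j≡c) j<c
    ... | tri> _ _ c<j = begin
      U r j * H j c              ≡⟨ cong (U r j *_) (upper j c c<j) ⟩
      U r j * 0ℤ                 ≡⟨ *-zeroʳ (U r j) ⟩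
      0ℤ                         ≡⟨ sym (cong₂ _+_ (trans (cong (I r j *_) (upper j c c<j)) (*-zeroʳ (I r j)))
                                                   (trans (cong (_* X) (I-offDiagonal (λ j≡c → ℕₚ.<-irrefl (cong toℕ (sym j≡c)) c<j))) (*-zeroˡ X))) ⟩
      I r j * H j c + I j c * X  ∎
    ... | tri≈ _ j≡c _ with Finₚ.toℕ-injective j≡c
    ...   | refl = begin
      U r j * H j j                              ≡⟨ solve 3 (λ u i h → u :* h := i :* h :+ con 1ℤ :* ((u :- i) :* h)) refl (U r j) (I r j) (H j j) ⟩
      I r j * H j j + 1ℤ * X                     ≡⟨ cong (λ e → I r j * H j j + e * X) (sym (I-diagonal j)) ⟩
      I r j * H j j + I j j * X                  ∎

  private
    exceeds : ∀ {a b} n h → 0ℤ ≤ a → b < + h → b ≡ a + + suc n * + h → ⊥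
    exceeds {+ a} n h _ b<h b≡ = ℕₚ.<⇒≱ (drop-+ (subst (_< + h) b≡′ b<h))
      (ℕₚ.≤-trans (ℕₚ.m≤m+n h (n ℕ.* h)) (ℕₚ.m≤n+m (h ℕ.+ n ℕ.* h) a))
      where
      b≡′ = trans b≡ (trans (cong (_+_ (+ a)) (sym (pos-* (suc n) h))) (sym (pos-+ a (suc n ℕ.* h))))
      drop-+ : ∀ {x y} → + x < + y → x ℕ.< y
      drop-+ (ℤ.+<+ x<y) = x<y

  residue-unique : ∀ {a b x} h → 0ℤ ≤ a → a < + h → 0ℤ ≤ b → b < + h → b ≡ a + x * + h → x ≡ 0ℤ
  residue-unique {x = + zero}   h _ _ _ _ _ = refl
  residue-unique {x = + suc n}  h 0≤a _ _ b<h b≡ = ⊥-elim (exceeds n h 0≤a b<h b≡)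
  residue-unique {a} {b} {x = -[1+ n ]} h _ a<h 0≤b _ b≡ = ⊥-elim (exceeds n h 0≤b a<h a≡)
    where
    a≡ : a ≡ b + + suc n * + h
    a≡ = begin
      a                                       ≡⟨ solve 2 (λ a y → a := a :+ (:- y) :+ y) refl a (+ suc n * + h) ⟩
      a + - (+ suc n * + h) + + suc n * + h   ≡⟨ cong (λ z → a + z + + suc n * + h) (neg-distribˡ-* (+ suc n) (+ h)) ⟩
      a + -[1+ n ] * + h + + suc n * + h      ≡⟨ cong (_+ + suc n * + h) (sym b≡) ⟩
      b + + suc n * + h                       ∎
      where open ≡-Reasoning

  unit-factors : ∀ {a b h₂} p → 0ℤ ≤ h₂ → h₂ ≡ a * + suc p → + suc p ≡ b * h₂ → a ≡ 1ℤ × b ≡ 1ℤ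
  unit-factors {a} {b} {h₂} p 0≤h₂ h₂≡ah₁ h₁≡bh₂ = a≡1 , b≡1
    where
    nonneg-factor : ∀ a → 0ℤ ≤ a * + suc p → 0ℤ ≤ a
    nonneg-factor (+ n) _ = ℤ.+≤+ ℕ.z≤n
    ba≡1 : b * a ≡ 1ℤ
    ba≡1 = *-cancelʳ-≡ (b * a) 1ℤ (+ suc p) (begin
      b * a * + suc p    ≡⟨ *-assoc b a (+ suc p) ⟩
      b * (a * + suc p)  ≡⟨ cong (b *_) (sym h₂≡ah₁) ⟩
      b * h₂             ≡⟨ sym h₁≡bh₂ ⟩
      + suc p            ≡⟨ sym (*-identityˡ (+ suc p)) ⟩
      1ℤ * + suc p       ∎)
      where open ≡-Reasoning
    a≡1 : a ≡ 1ℤ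
    a≡1 = trans (sym (0≤i⇒+∣i∣≡i (nonneg-factor a (subst (0ℤ ≤_) h₂≡ah₁ 0≤h₂))))
                (cong +_ (ℕₚ.m*n≡1⇒n≡1 ∣ b ∣ ∣ a ∣ (trans (sym (abs-* b a)) (cong ∣_∣ ba≡1))))
    b≡1 : b ≡ 1ℤ
    b≡1 = *-cancelʳ-≡ b 1ℤ (+ suc p)
      (trans (cong (b *_) (sym (trans h₂≡ah₁ (trans (cong (_* + suc p) a≡1) (*-identityˡ (+ suc p))))))
             (trans (sym h₁≡bh₂) (sym (*-identityˡ (+ suc p)))))

  positive⇒suc : ∀ {x} → 0ℤ < x → ∃ λ p → x ≡ + suc p
  positive⇒suc {+ suc p} _            = p , refl
  positive⇒suc {+ zero}  (ℤ.+<+ ())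

  offDiagonal-inRange : ∀ {d} {H : Matrix d} → HermiteUpTo d H → ∀ {r c} → 0ℤ < H c c → r ≢ c → 0ℤ ≤ H r c × H r c < H c c
  offDiagonal-inRange {H = H} hermite {r} {c} 0<Hcc r≢c with ℕₚ.<-cmp (toℕ r) (toℕ c)
  ... | tri< r<c _ _ = HermiteUpTo.reduced-above hermite (Finₚ.toℕ<n c) r<c 0<Hcc
  ... | tri≈ _ r≡c _ = ⊥-elim (r≢c (Finₚ.toℕ-injective r≡c))
  ... | tri> _ _ c<r = subst (λ x → 0ℤ ≤ x × x < H c c) (sym (HermiteUpTo-upperTriangular hermite r c c<r)) (≤-refl , 0<Hcc)

  diagonal-shift : ∀ {d} (c : Fin d) w x {y} → y ≡ x + (w - I c c) * x → y ≡ w * x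
  diagonal-shift c w x y≡ = trans y≡ (trans (cong (λ i → x + (w - i) * x) (I-diagonal c))
    (solve 2 (λ w x → x :+ (w :- con 1ℤ) :* x := w :* x) refl w x))

  offDiagonal-shift : ∀ {d} {r c : Fin d} w x z {y} → r ≢ c → y ≡ x + (w - I r c) * z → y ≡ x + w * z
  offDiagonal-shift w x z r≢c y≡ =
    trans y≡ (trans (cong (λ i → x + (w - i) * z) (I-offDiagonal r≢c)) (cong (λ w → x + w * z) (+-identityʳ w)))

  module _ {d} {H₁ H₂ U V : Matrix d} (hnf₁ : IsHNF H₁) (hermite₂ : HermiteUpTo d H₂)
           (UH₁≈H₂ : (U *M H₁) ≈M H₂) (VH₂≈H₁ : (V *M H₂) ≈M H₁) where

    module Column (c : Fin d) (earlier : ∀ {j} → toℕ j ℕ.< toℕ c → ∀ r → U r j ≡ I r j × V r j ≡ I r j) where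

      private
        hermite₁ = proj₁ hnf₁
        p = proj₁ (positive⇒suc (proj₂ hnf₁ c))
        h = + suc p
        H₁cc≡h : H₁ c c ≡ h
        H₁cc≡h = proj₂ (positive⇒suc (proj₂ hnf₁ c))
        H₂-column : ∀ r → H₂ r c ≡ H₁ r c + (U r c - I r c) * H₁ c c
        H₂-column r = trans (sym (UH₁≈H₂ r c))
          (*M-column U H₁ c (HermiteUpTo-upperTriangular hermite₁) (λ j<c r → proj₁ (earlier j<c r)) r)
        H₁-column : ∀ r → H₁ r c ≡ H₂ r c + (V r c - I r c) * H₂ c c
        H₁-column r = trans (sym (VH₂≈H₁ r c))
          (*M-column V H₂ c (HermiteUpTo-upperTriangular hermite₂) (λ j<c r → proj₂ (earlier j<c r)) r)

      diagonal-units : U c c ≡ 1ℤ × V c c ≡ 1ℤ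
      diagonal-units = unit-factors p (HermiteUpTo.diagonal-nonneg hermite₂ (Finₚ.toℕ<n c))
        (trans (diagonal-shift c (U c c) (H₁ c c) (H₂-column c)) (cong (U c c *_) H₁cc≡h))
        (trans (sym H₁cc≡h) (diagonal-shift c (V c c) (H₂ c c) (H₁-column c)))

      H₂cc≡h : H₂ c c ≡ h
      H₂cc≡h = trans (diagonal-shift c (U c c) (H₁ c c) (H₂-column c)) (trans (cong₂ _*_ (proj₁ diagonal-units) H₁cc≡h) (*-identityˡ h))

      offDiagonal-zero : ∀ {r} → r ≢ c → U r c ≡ 0ℤ × V r c ≡ 0ℤ
      offDiagonal-zero {r} r≢c with in-range hermite₁ H₁cc≡h | in-range hermite₂ H₂cc≡h
        where
        in-range : ∀ {H : Matrix d} → HermiteUpTo d H → H c c ≡ h → 0ℤ ≤ H r c × H r c < h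
        in-range {H} hermite Hcc≡h with offDiagonal-inRange hermite (subst (0ℤ <_) (sym Hcc≡h) (ℤ.+<+ (ℕ.s≤s ℕ.z≤n))) r≢c
        ... | 0≤Hrc , Hrc<Hcc = 0≤Hrc , subst (H r c <_) Hcc≡h Hrc<Hcc
      ... | 0≤H₁rc , H₁rc<h | 0≤H₂rc , H₂rc<h =
        residue-unique (suc p) 0≤H₁rc H₁rc<h 0≤H₂rc H₂rc<h
          (trans (offDiagonal-shift (U r c) (H₁ r c) (H₁ c c) r≢c (H₂-column r)) (cong (λ x → H₁ r c + U r c * x) H₁cc≡h)) ,
        residue-unique (suc p) 0≤H₂rc H₂rc<h 0≤H₁rc H₁rc<h
          (trans (offDiagonal-shift (V r c) (H₂ r c) (H₂ c c) r≢c (H₁-column r)) (cong (λ x → H₂ r c + V r c * x) H₂cc≡h))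

      column-identity : ∀ r → U r c ≡ I r c × V r c ≡ I r c
      column-identity r with toSum (r Fin.≟ c)
      ... | inj₁ refl = trans (proj₁ diagonal-units) (sym (I-diagonal c)) , trans (proj₂ diagonal-units) (sym (I-diagonal c))
      ... | inj₂ r≢c  = trans (proj₁ (offDiagonal-zero r≢c)) (sym (I-offDiagonal r≢c)) ,
                        trans (proj₂ (offDiagonal-zero r≢c)) (sym (I-offDiagonal r≢c))

    columns-identity : ∀ n {c} → toℕ c ℕ.< n → ∀ r → U r c ≡ I r c × V r c ≡ I r c
    columns-identity (suc n) {c} c<1+n with ℕₚ.m<1+n⇒m<n∨m≡n c<1+n
    ... | inj₁ c<n = columns-identity n c<n
    ... | inj₂ c≡n = Column.column-identity c (λ j<c → columns-identity n (subst (_ ℕ.<_) c≡n j<c))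

  -- Only H₁ needs positive pivots: H₂ c c = U c c * H₁ c c forces them for H₂, so the normal forms
  -- computed by the loop need not come from nonsingular matrices.
  hnf-unique : ∀ {d} {H₁ H₂ : Matrix d} → IsHNF H₁ → HermiteUpTo d H₂ → RowEquivalent H₁ H₂ → H₁ ≈M H₂
  hnf-unique {d} {H₁} {H₂} hnf₁ hermite₂ H₁~H₂ r c with H₁~H₂ | RowEquivalent-sym H₁~H₂
  ... | U , _ , UH₁≈H₂ | V , _ , VH₂≈H₁ = begin
    H₁ r c                       ≡⟨ sym (*M-identityˡ H₁ r c) ⟩
    ∑ d (λ j → I r j * H₁ j c)   ≡⟨ ∑-cong d (λ j → cong (_* H₁ j c) (sym (U≡I j))) ⟩
    (U *M H₁) r c                ≡⟨ UH₁≈H₂ r c ⟩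
    H₂ r c                       ∎
    where
    open ≡-Reasoning
    U≡I : ∀ j → U r j ≡ I r j
    U≡I j = proj₁ (columns-identity {U = U} {V} hnf₁ hermite₂ UH₁≈H₂ VH₂≈H₁ (suc (toℕ j)) ℕₚ.≤-refl r)

module EHEMCorrectness where

  open Matrices
  open HermiteAlgorithm using (hnf-RowEquivalent; hnf-hermite; hnf-isHNF)
  open HermiteUniqueness using (hnf-unique)
  open import Data.Fin.Permutation as Perm using (Permutation′; _⟨$⟩ʳ_; _∘ₚ_)
  import Data.Fin.Permutation.Components as PermComponents
  open import Data.List as List using (List; []; _∷_; allFin)
  open import Data.List.Scans.Base using (scanl)
  open import Data.List.Membership.Propositional using (_∈_)
  open import Data.List.Membership.Propositional.Properties using (∈-allFin)
  open import Data.List.Relation.Unary.Any using (Any; here; there)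
  open import Data.List.Relation.Unary.All using (All; []; _∷_)
  open import Data.Maybe using (just; Is-just)
  import Data.Maybe.Relation.Unary.Any as Maybe

  allᵇ-sound : ∀ {A : Set} (p : A → Bool) xs → allᵇ p xs ≡ true → ∀ {x} → x ∈ xs → p x ≡ true
  allᵇ-sound p (y ∷ ys) all-p x∈ with p y in py
  allᵇ-sound p (y ∷ ys) all-p (here refl)  | true = py
  allᵇ-sound p (y ∷ ys) all-p (there x∈ys) | true = allᵇ-sound p ys all-p x∈ys

  allᵇ-complete : ∀ {A : Set} (p : A → Bool) xs → (∀ x → p x ≡ true) → allᵇ p xs ≡ true
  allᵇ-complete p []       all-p = refl
  allᵇ-complete p (y ∷ ys) all-p rewrite all-p y = allᵇ-complete p ys all-p

  ≟-sound : ∀ (a b : ℤ) → ⌊ a ℤ.≟ b ⌋ ≡ true → a ≡ b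
  ≟-sound a b eq with a ℤ.≟ b
  ... | yes a≡b = a≡b

  ≟-complete : ∀ (a b : ℤ) → a ≡ b → ⌊ a ℤ.≟ b ⌋ ≡ true
  ≟-complete a b a≡b with a ℤ.≟ b
  ... | yes _   = refl
  ... | no a≢b  = ⊥-elim (a≢b a≡b)

  eqM-sound : ∀ {d} (M N : Matrix d) → proj₁ (eqM M N) ≡ true → M ≈M N
  eqM-sound {d} M N eq r c = ≟-sound (M r c) (N r c)
    (allᵇ-sound _ (allFin d) (allᵇ-sound _ (allFin d) eq (∈-allFin r)) (∈-allFin c))

  eqM-complete : ∀ {d} (M N : Matrix d) → M ≈M N → proj₁ (eqM M N) ≡ true
  eqM-complete {d} M N M≈N =
    allᵇ-complete _ (allFin d) (λ r → allᵇ-complete _ (allFin d) (λ c → ≟-complete (M r c) (N r c) (M≈N r c)))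

  IsPermutation : ∀ {d} → (Fin d → Fin d) → Set
  IsPermutation {d} σ = Σ (Permutation′ d) λ π → ∀ k → π ⟨$⟩ʳ k ≡ σ k

  IsPermutation-id : ∀ {d} → IsPermutation {d} id
  IsPermutation-id = Perm.id , λ _ → refl

  IsPermutation-∘ : ∀ {d} {σ τ : Fin d → Fin d} → IsPermutation σ → IsPermutation τ → IsPermutation (σ ∘ τ)
  IsPermutation-∘ {σ = σ} (π , π≗σ) (ρ , ρ≗τ) = ρ ∘ₚ π , λ k → trans (π≗σ (ρ ⟨$⟩ʳ k)) (cong σ (ρ≗τ k))

  IsPermutation-adj : ∀ {d} (τ : Adj d) → IsPermutation (adj⇒fun τ)
  IsPermutation-adj τ = Perm.transpose (Adj.i τ) (Adj.j τ) , transpose≗swapFin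
    where
    transpose≗swapFin : ∀ k → PermComponents.transpose (Adj.i τ) (Adj.j τ) k ≡ swapFin (Adj.i τ) (Adj.j τ) k
    transpose≗swapFin k with k Fin.≟ Adj.i τ
    ... | yes _ = refl
    ... | no _ with k Fin.≟ Adj.j τ
    ...   | yes _ = refl
    ...   | no _  = refl

  visited : ∀ {d} → (Fin d → Fin d) → List (Fin d → Fin d) → List (Fin d → Fin d)
  visited σ []       = []
  visited σ (τ ∷ τs) = σ ∘ τ ∷ visited (σ ∘ τ) τs

  scanl-visited : ∀ {d} (σ : Fin d → Fin d) (τs : List (Adj d)) →
    scanl (λ σ τ → σ ∘ adj⇒fun τ) σ τs ≡ σ ∷ visited σ (List.map adj⇒fun τs)
  scanl-visited σ []       = refl
  scanl-visited σ (τ ∷ τs) = cong (σ ∷_) (scanl-visited (σ ∘ adj⇒fun τ) τs)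

  RowEquivalent-nextNormalForm : ∀ {d} (B : Matrix d) {Hi} σ τ → RowEquivalent (B · σ) Hi →
    RowEquivalent (B · (σ ∘ τ)) (H (Hi · τ))
  RowEquivalent-nextNormalForm B {Hi} σ τ Bσ~Hi = RowEquivalent-trans (RowEquivalent-· τ Bσ~Hi) (hnf-RowEquivalent (Hi · τ))

  module _ {d} (A : Matrix d) (B : Matrix d) where

    private
      F = H A

    ehemLoop-sound : ∀ τs (Hi : Matrix d) σ c {σ′} → All IsPermutation τs → IsPermutation σ → RowEquivalent (B · σ) Hi →
      proj₁ (ehemLoop F Hi σ c τs) ≡ just σ′ → RowEquivalent A (B · σ′) × IsPermutation σ′
    ehemLoop-sound (τ ∷ τs) Hi σ c (τ-perm ∷ τs-perm) σ-perm Bσ~Hi found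
      with proj₁ (eqM (H (Hi · τ)) F) in test
    ... | true with found
    ...   | refl = RowEquivalent-trans (hnf-RowEquivalent A)
                     (RowEquivalent-sym (RowEquivalent-respʳ (RowEquivalent-nextNormalForm B σ τ Bσ~Hi) (eqM-sound (H (Hi · τ)) F test))) ,
                   IsPermutation-∘ σ-perm τ-perm
    ehemLoop-sound (τ ∷ τs) Hi σ c (τ-perm ∷ τs-perm) σ-perm Bσ~Hi found | false =
      ehemLoop-sound τs (H (Hi · τ)) (σ ∘ τ) _ τs-perm (IsPermutation-∘ σ-perm τ-perm) (RowEquivalent-nextNormalForm B σ τ Bσ~Hi) found

    ehemLoop-complete : Nonsingular A → ∀ {π U} → Unimodular U → (U *M A) ≈M (B · π) →
      ∀ τs (Hi : Matrix d) σ c → RowEquivalent (B · σ) Hi → Any (λ ρ → ∀ k → ρ k ≡ π k) (visited σ τs) →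
      Is-just (proj₁ (ehemLoop F Hi σ c τs))
    ehemLoop-complete nonsingular {π} {U} U-unimodular UA≈Bπ (τ ∷ τs) Hi σ c Bσ~Hi π-visited
      with proj₁ (eqM (H (Hi · τ)) F) in test
    ... | true = Maybe.just _
    ... | false with π-visited
    ...   | here στ≗π = ⊥-elim (true≢false (trans (sym (eqM-complete Hn F (≈M-sym F≈Hn))) test))
      where
      Hn = H (Hi · τ)
      true≢false : true ≢ false
      true≢false ()
      F~Hn : RowEquivalent F Hn
      F~Hn = RowEquivalent-trans (RowEquivalent-sym (hnf-RowEquivalent A))
        (RowEquivalent-trans (U , U-unimodular , UA≈Bπ)
        (RowEquivalent-trans (RowEquivalent-reflexive (λ r k → cong (B r) (sym (στ≗π k))))
        (RowEquivalent-nextNormalForm B σ τ Bσ~Hi)))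
      F≈Hn : F ≈M Hn
      F≈Hn = hnf-unique (hnf-isHNF A nonsingular) (hnf-hermite (Hi · τ)) F~Hn
    ...   | there π-visited′ = ehemLoop-complete nonsingular U-unimodular UA≈Bπ τs (H (Hi · τ)) (σ ∘ τ) _
        (RowEquivalent-nextNormalForm B σ τ Bσ~Hi) π-visited′

  EHEM-sound : ∀ {d} (A B : Matrix d) τs {σ} → proj₁ (EHEM A B τs) ≡ just σ → RowEquivalent A (B · σ) × IsPermutation σ
  EHEM-sound A B τs = ehemLoop-sound A B (id ∷ List.map adj⇒fun τs) B id (proj₂ (hnf A))
    (IsPermutation-id ∷ adjacent-permutations τs) IsPermutation-id (RowEquivalent-reflexive ≈M-refl)
    where
    adjacent-permutations : ∀ τs → All IsPermutation (List.map adj⇒fun τs)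
    adjacent-permutations []       = []
    adjacent-permutations (τ ∷ τs) = IsPermutation-adj τ ∷ adjacent-permutations τs

  EHEM-complete : ∀ {d} (A B : Matrix d) τs → ValidOrdering d τs → Nonsingular A → UPEquivalent A B →
    Is-just (proj₁ (EHEM A B τs))
  EHEM-complete A B τs (_ , every-π-listed) nonsingular (U , π , U-unimodular , UA≈Bπ) =
    ehemLoop-complete A B nonsingular U-unimodular UA≈Bπ (id ∷ List.map adj⇒fun τs) B id (proj₂ (hnf A))
      (RowEquivalent-reflexive ≈M-refl) (subst (Any _) (scanl-visited id τs) (every-π-listed π))

  EHEM-found⇒UPEquivalent : ∀ {d} (A B : Matrix d) τs → Is-just (proj₁ (EHEM A B τs)) → UPEquivalent A B
  EHEM-found⇒UPEquivalent A B τs is-just with proj₁ (EHEM A B τs) in found | is-just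
  ... | just σ | _ with EHEM-sound A B τs found
  ...   | (U , U-unimodular , UA≈Bσ) , (π , π≗σ) = U , π , U-unimodular , λ r k → trans (UA≈Bσ r k) (cong (B r) (sym (π≗σ k)))

module EHEMCost where

  open import Data.Nat using (_+_; _*_; _≤_; _^_; _!; s≤s; z≤n)
  open import Data.Nat.Properties
  open import Data.Nat.Solver using (module +-*-Solver)
  open +-*-Solver
  open import Data.List as List using (List; []; _∷_; foldl; length; allFin; filterᵇ)
  import Data.List.Properties as List
  open import Relation.Nullary.Decidable using (T?)

  foldl-cost : ∀ {X S : Set} (f : S × ℕ → X → S × ℕ) (b : ℕ) → (∀ st x → proj₂ (f st x) ≤ proj₂ st + b) →
    ∀ xs st → proj₂ (foldl f st xs) ≤ proj₂ st + length xs * b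
  foldl-cost f b step-cost []       st = m≤m+n (proj₂ st) 0
  foldl-cost f b step-cost (x ∷ xs) st = begin
    proj₂ (foldl f (f st x) xs)        ≤⟨ foldl-cost f b step-cost xs (f st x) ⟩
    proj₂ (f st x) + length xs * b     ≤⟨ +-monoˡ-≤ (length xs * b) (step-cost st x) ⟩
    proj₂ st + b + length xs * b       ≡⟨ +-assoc (proj₂ st) b (length xs * b) ⟩
    proj₂ st + (b + length xs * b)     ∎
    where open ≤-Reasoning

  eliminateCost fixSignCost reduceCost columnCost hnfCost loopStepCost : ℕ → ℕ
  eliminateCost d = 4 + 6 * d
  fixSignCost   d = 1 + d
  reduceCost    d = 2 + 2 * d
  columnCost    d = d * eliminateCost d + fixSignCost d + d * reduceCost d
  hnfCost       d = d * columnCost d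
  loopStepCost  d = hnfCost d + d * d

  module _ {d} (k : Fin d) where

    eliminate-cost : ∀ (st : Costed (Matrix d)) i → proj₂ (eliminate k st i) ≤ proj₂ st + eliminateCost d
    eliminate-cost (M , c) i with isZero (M i k)
    ... | true  = +-monoʳ-≤ c (s≤s z≤n)
    ... | false = ≤-reflexive (+-assoc c 4 (6 * d))

    fixSign-cost : ∀ (st : Costed (Matrix d)) → proj₂ (fixSign k st) ≤ proj₂ st + fixSignCost d
    fixSign-cost (M , c) with isNeg (M k k)
    ... | true  = ≤-reflexive (+-assoc c 1 d)
    ... | false = +-monoʳ-≤ c (s≤s z≤n)

    reduce-cost : ∀ (st : Costed (Matrix d)) i → proj₂ (reduce k st i) ≤ proj₂ st + reduceCost d
    reduce-cost (M , c) i with M k k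
    ... | + suc p  = ≤-reflexive (+-assoc c 2 (2 * d))
    ... | + zero   = +-monoʳ-≤ c (s≤s z≤n)
    ... | -[1+ n ] = +-monoʳ-≤ c (s≤s z≤n)

    length-filter-allFin : ∀ (p : Fin d → Bool) → length (filterᵇ p (allFin d)) ≤ d
    length-filter-allFin p = ≤-trans (List.length-filter (T? ∘ p) (allFin d)) (≤-reflexive (List.length-tabulate id))

    processColumn-cost : ∀ (st : Costed (Matrix d)) → proj₂ (processColumn st k) ≤ proj₂ st + columnCost d
    processColumn-cost st = begin
      proj₂ (processColumn st k)
        ≤⟨ foldl-cost (reduce k) (reduceCost d) reduce-cost (above k) st₂ ⟩
      proj₂ st₂ + length (above k) * reduceCost d
        ≤⟨ +-mono-≤ (fixSign-cost st₁) (*-monoˡ-≤ (reduceCost d) (length-filter-allFin _)) ⟩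
      proj₂ st₁ + fixSignCost d + d * reduceCost d
        ≤⟨ +-monoˡ-≤ (d * reduceCost d) (+-monoˡ-≤ (fixSignCost d) (foldl-cost (eliminate k) (eliminateCost d) eliminate-cost (below k) st)) ⟩
      proj₂ st + length (below k) * eliminateCost d + fixSignCost d + d * reduceCost d
        ≤⟨ +-monoˡ-≤ (d * reduceCost d) (+-monoˡ-≤ (fixSignCost d) (+-monoʳ-≤ (proj₂ st) (*-monoˡ-≤ (eliminateCost d) (length-filter-allFin _)))) ⟩
      proj₂ st + d * eliminateCost d + fixSignCost d + d * reduceCost d
        ≡⟨ solve 4 (λ c e f r → c :+ e :+ f :+ r := c :+ (e :+ f :+ r)) refl (proj₂ st) (d * eliminateCost d) (fixSignCost d) (d * reduceCost d) ⟩
      proj₂ st + columnCost d ∎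
      where
      open ≤-Reasoning
      st₁ = foldl (eliminate k) st (below k)
      st₂ = fixSign k st₁

  hnf-cost : ∀ {d} (M : Matrix d) → proj₂ (hnf M) ≤ hnfCost d
  hnf-cost {d} M = ≤-trans (foldl-cost processColumn (columnCost d) (λ st k → processColumn-cost k st) (allFin d) (M , 0))
    (≤-reflexive (cong (_* columnCost d) (List.length-tabulate {n = d} id)))

  loopStep-cost : ∀ {d} (M N : Matrix d) c → c + proj₂ (hnf M) + proj₂ (eqM (H M) N) ≤ c + loopStepCost d
  loopStep-cost {d} M N c = ≤-trans (≤-reflexive (+-assoc c _ (d * d))) (+-monoʳ-≤ c (+-monoˡ-≤ (d * d) (hnf-cost M)))

  ehemLoop-cost : ∀ {d} (F : Matrix d) τs Hi σ c → proj₂ (ehemLoop F Hi σ c τs) ≤ c + length τs * loopStepCost d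
  ehemLoop-cost F []       Hi σ c = m≤m+n c 0
  ehemLoop-cost {d} F (τ ∷ τs) Hi σ c with proj₁ (eqM (H (Hi · τ)) F)
  ... | true  = begin
    c + proj₂ (hnf (Hi · τ)) + d * d                  ≤⟨ loopStep-cost (Hi · τ) F c ⟩
    c + loopStepCost d                                ≤⟨ +-monoʳ-≤ c (m≤m+n (loopStepCost d) (length τs * loopStepCost d)) ⟩
    c + (loopStepCost d + length τs * loopStepCost d) ∎
    where open ≤-Reasoning
  ... | false = begin
    proj₂ (ehemLoop F (H (Hi · τ)) (σ ∘ τ) (c + proj₂ (hnf (Hi · τ)) + d * d) τs)
      ≤⟨ ehemLoop-cost F τs (H (Hi · τ)) (σ ∘ τ) _ ⟩
    c + proj₂ (hnf (Hi · τ)) + d * d + length τs * loopStepCost d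
      ≤⟨ +-monoˡ-≤ (length τs * loopStepCost d) (loopStep-cost (Hi · τ) F c) ⟩
    c + loopStepCost d + length τs * loopStepCost d
      ≡⟨ +-assoc c (loopStepCost d) (length τs * loopStepCost d) ⟩
    c + (loopStepCost d + length τs * loopStepCost d) ∎
    where open ≤-Reasoning

  EHEM-cost : ∀ {d} (A B : Matrix d) τs → length τs ≡ d ! ℕ.∸ 1 → proj₂ (EHEM A B τs) ≤ hnfCost d + d ! * loopStepCost d
  EHEM-cost {d} A B τs length≡ = ≤-trans (ehemLoop-cost (H A) (id ∷ List.map adj⇒fun τs) B id (proj₂ (hnf A)))
    (+-mono-≤ (hnf-cost A) (≤-reflexive (cong (_* loopStepCost d) loop-length)))
    where
    loop-length : length (id ∷ List.map adj⇒fun τs) ≡ d !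
    loop-length = trans (cong suc (trans (List.length-map adj⇒fun τs) length≡)) (m+[n∸m]≡n (1≤n! d))

  -- hnfCost d = 8d³ + 7d² + d and loopStepCost d = 8d³ + 8d² + d, so with d = n + 1 the slack
  -- up to 33 d³ is 17n³ + 36n² + 19n.
  hnfCost+loopStepCost≤ : ∀ n → hnfCost (suc n) + loopStepCost (suc n) ≤ 33 * suc n ^ 3
  hnfCost+loopStepCost≤ n = m+n≡o⇒m≤o (solve 1 (λ n →
    let d = con 1 :+ n
        h = d :* (d :* (con 4 :+ con 6 :* d) :+ (con 1 :+ d) :+ d :* (con 2 :+ con 2 :* d))
    in h :+ (h :+ d :* d) :+ (con 17 :* n :^ 3 :+ con 36 :* n :^ 2 :+ con 19 :* n) := con 33 :* d :^ 3) refl n)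
    where
    m+n≡o⇒m≤o : ∀ {m n o} → m + n ≡ o → m ≤ o
    m+n≡o⇒m≤o {m} {n} refl = m≤m+n m n

  EHEM-cost-bound : ∀ d → 1 ≤ d → hnfCost d + d ! * loopStepCost d ≤ 33 * (d ! * d ^ 3)
  EHEM-cost-bound (suc n) _ = begin
    hnfCost d + d ! * loopStepCost d       ≤⟨ +-monoˡ-≤ (d ! * loopStepCost d) (m≤n*m (hnfCost d) (d !) {{d !≢0}}) ⟩
    d ! * hnfCost d + d ! * loopStepCost d ≡⟨ sym (*-distribˡ-+ (d !) (hnfCost d) (loopStepCost d)) ⟩
    d ! * (hnfCost d + loopStepCost d)     ≤⟨ *-monoʳ-≤ (d !) (hnfCost+loopStepCost≤ n) ⟩
    d ! * (33 * d ^ 3)                     ≡⟨ solve 2 (λ f x → f :* (con 33 :* x) := con 33 :* (f :* x)) refl (d !) (d ^ 3) ⟩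
    33 * (d ! * d ^ 3)                     ∎
    where
    open ≤-Reasoning
    d = suc n

open import Data.Nat using (_≤_; _≥_; _*_; _^_; _!)
open import Data.List using (List)
open import Data.Maybe using (Is-just; just)
open import Function.Bundles using (_⇔_; mk⇔)
open EHEMCorrectness using (EHEM-sound; EHEM-complete; EHEM-found⇒UPEquivalent)
open EHEMCost using (EHEM-cost; EHEM-cost-bound)

proposition3p4 :
    -- correctness: EHEM decides UP-equivalence (and a returned σ is a witness)
    (∀ (d : ℕ) (A B : Matrix d) (τs : List (Adj d)) → ValidOrdering d τs →
       Nonsingular A → Nonsingular B → ∣ det A ∣ ≡ ∣ det B ∣ →
       (Is-just (proj₁ (EHEM A B τs)) ⇔ UPEquivalent A B)
       × (∀ (σ : Fin d → Fin d) → proj₁ (EHEM A B τs) ≡ just σ →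
            Σ (Matrix d) λ U → Unimodular U × ((U *M A) ≈M (B · σ))))
    ×
    -- running time: O(d! · d³) arithmetic operations
    (∃ λ (c : ℕ) → ∃ λ (N : ℕ) →
       ∀ (d : ℕ) → d ≥ N → (A B : Matrix d) (τs : List (Adj d)) → ValidOrdering d τs →
         Nonsingular A → Nonsingular B → ∣ det A ∣ ≡ ∣ det B ∣ →
         proj₂ (EHEM A B τs) ≤ c * (d ! * d ^ 3))
proposition3p4 = correctness , 33 , 1 , running-time
  where
  correctness : ∀ d (A B : Matrix d) τs → ValidOrdering d τs → Nonsingular A → Nonsingular B → ∣ det A ∣ ≡ ∣ det B ∣ →
    (Is-just (proj₁ (EHEM A B τs)) ⇔ UPEquivalent A B) ×
    (∀ σ → proj₁ (EHEM A B τs) ≡ just σ → Σ (Matrix d) λ U → Unimodular U × ((U *M A) ≈M (B · σ)))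
  correctness d A B τs valid nonsingular _ _ =
    mk⇔ (EHEM-found⇒UPEquivalent A B τs) (EHEM-complete A B τs valid nonsingular) ,
    λ σ found → proj₁ (EHEM-sound A B τs found)
  running-time : ∀ d → d ≥ 1 → (A B : Matrix d) (τs : List (Adj d)) → ValidOrdering d τs →
    Nonsingular A → Nonsingular B → ∣ det A ∣ ≡ ∣ det B ∣ → proj₂ (EHEM A B τs) ≤ 33 * (d ! * d ^ 3)
  running-time d d≥1 A B τs (length≡ , _) _ _ _ = ℕₚ.≤-trans (EHEM-cost A B τs length≡) (EHEM-cost-bound d d≥1)
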